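{- Let $G=(V,E)\in\mathcal{G}_{\mathcal{R}^{(1)},\mathcal{R}^{(2)}}$, let $U=\mathcal{R}^{(3)}(G)$, let $k$ be a positive integer and $\epsilon>0$ be such that every vertex cover of $G$ has size at least $k(1+\epsilon)$, and let $\mathcal{C}$ be a $k$-clustering of $U$ of minimum total impurity. Let $e$ be the number of clusters of $\mathcal{C}$ in the $e$-group and $q$ the total number of vectors in these clusters. If $q<4e$, then the sum of the impurities of the clusters in the $e$-group is at least $16(q-3e)+(4e-q)(2+6\log 3)$.
   Context: All graphs are simple and undirected. Map $\mathcal{R}^{(1)}$: given a 4-regular graph $G'=(V',E')$ with $n$ vertices, choose $\hat E\subseteq E'$ with $|\hat E|=n$ such that $(V',\hat E)$ is bipartite; $\mathcal{R}^{(1)}(G')$ replaces each edge $(u,v)\in E'\setminus\hat E$ by a path $u,u',v',v$ with new vertices $u',v'$. Map $\mathcal{R}^{(2)}$: given $H$ of maximum degree at most 4, each degree-4 vertex $v$ with neighbours $w_1,\dots,w_4$ is replaced by a path $v_a,v_b,v_c$ of new vertices plus edges $(v_a,w_1),(v_a,w_2),(v_c,w_3),(v_c,w_4)$. $\mathcal{G}_{\mathcal{R}^{(1)},\mathcal{R}^{(2)}}$ is the set of graphs $\mathcal{R}^{(2)}(\mathcal{R}^{(1)}(G'))$, $G'$ 4-regular (they are triangle-free with maximum degree $\le3$). For $G$ with vertices $v_1,\dots,v_n$, $U=\mathcal{R}^{(3)}(G)=\{v^e:e\in E\}\subseteq\mathbb{R}^n$, where $v^e$ for $e=(v_i,v_j)$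 has 1 in coordinates $i,j$ and 0 elsewhere; a set of vectors of $U$ is identified with the corresponding set of edges. For $\mathbf{w}\in\mathbb{R}^n_{\ge0}$, $I_{Ent}(\mathbf{w})=\|\mathbf{w}\|_1\sum_i\frac{w_i}{\|\mathbf{w}\|_1}\log\frac{\|\mathbf{w}\|_1}{w_i}$ (base 2, zero terms omitted); for $C\subseteq U$, $I_{Ent}(C)=I_{Ent}(\sum_{\mathbf{v}\in C}\mathbf{v})$. A $k$-clustering is a partition of $U$ into $k$ nonempty clusters; its total impurity is the sum of the clusters' impurities. A cluster is a $p$-star if its $p$ edges all share a common vertex. The $e$-group of $\mathcal{C}$ consists of the clusters that are not a 3-star, not a 2-star, not a single edge, and not a pair of edges without common vertex.
   Formalization: The parameter ε in the vertex-cover hypothesis ranges over the positive rationals. -}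

module Defs where

open import Data.Bool using (Bool; true; false; _∧_; _∨_; not; if_then_else_; T)
open import Data.Nat as ℕ using (ℕ; zero; suc; _^_; _<_; _≤_; _∸_; _*_)
import Data.Nat.Properties as ℕP
open import Data.Fin as F using (Fin; zero; suc; splitAt; remQuot)
import Data.Fin.Properties as FP
open import Data.List using (List; []; _∷_; length; lookup; allFin; cartesianProduct; filterᵇ; map)
open import Data.Nat.ListAction using (sum; product)
open import Data.Product using (Σ; Σ-syntax; ∃; ∃-syntax; _×_; _,_; proj₁; proj₂)
open import Data.Sum using (_⊎_; inj₁; inj₂)
open import Relation.Nullary using (¬_)
open import Relation.Nullary.Decidable using (⌊_⌋)
open import Relation.Binary.PropositionalEquality using (_≡_; _≢_)
open import Function.Bundles using (_↔_; Inverse)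

sumF : ∀ n → (Fin n → ℕ) → ℕ
sumF n f = sum (map f (allFin n))

prodF : ∀ n → (Fin n → ℕ) → ℕ
prodF n f = product (map f (allFin n))

countF : ∀ {n} → (Fin n → Bool) → ℕ
countF {n} f = sumF n (λ i → if f i then 1 else 0)

_==ᶠ_ : ∀ {n} → Fin n → Fin n → Bool
i ==ᶠ j = ⌊ i F.≟ j ⌋

_<ᶠ_ : ∀ {n} → Fin n → Fin n → Bool
i <ᶠ j = ⌊ i F.<? j ⌋

record Graph : Set where
  constructor mkGraph
  field
    n   : ℕ
    adj : Fin n → Fin n → Bool
open Graph public

IsSimple : Graph → Set
IsSimple G = (∀ u v → adj G u v ≡ adj G v u) × (∀ u → adj G u u ≡ false)

deg : (G : Graph) → Fin (n G) → ℕ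
deg G u = countF (adj G u)

Is4Regular : Graph → Set
Is4Regular G = ∀ u → deg G u ≡ 4

-- the edge set {u,v}, each edge listed once as (u , v) with u < v
edgeList : ∀ {m} → (Fin m → Fin m → Bool) → List (Fin m × Fin m)
edgeList {m} a = filterᵇ (λ p → (proj₁ p <ᶠ proj₂ p) ∧ a (proj₁ p) (proj₂ p))
                         (cartesianProduct (allFin m) (allFin m))

ValidHat : (G' : Graph) → (Fin (n G') → Fin (n G') → Bool) → Set
ValidHat G' Ê =
  (∀ u v → Ê u v ≡ Ê v u) ×
  (∀ u v → Ê u v ≡ true → adj G' u v ≡ true) ×
  (length (edgeList Ê) ≡ n G') ×
  (Σ[ col ∈ (Fin (n G') → Bool) ] (∀ u v → Ê u v ≡ true → col u ≢ col v))

nonHat : (G' : Graph) → (Fin (n G') → Fin (n G') → Bool) → List (Fin (n G') × Fin (n G'))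
nonHat G' Ê = filterᵇ (λ p → not (Ê (proj₁ p) (proj₂ p))) (edgeList (adj G'))

-- new vertices: for the j-th edge (u,v) of E' ∖ Ê, (j,0) = u' and (j,1) = v'.
-- Vertex set of R⁽¹⁾(G') is Fin (n + m * 2), split as Fin n ⊎ (Fin m × Fin 2).
R1 : (G' : Graph) → (Fin (n G') → Fin (n G') → Bool) → Graph
R1 G' Ê = mkGraph (n G' ℕ.+ m * 2) a
  where
  L = nonHat G' Ê
  m = length L
  N = n G'
  endpoint : Fin m → Fin 2 → Fin N
  endpoint j zero = proj₁ (lookup L j)
  endpoint j (suc _) = proj₂ (lookup L j)
  cls : Fin (N ℕ.+ m * 2) → Fin N ⊎ (Fin m × Fin 2)
  cls x with splitAt N x
  ... | inj₁ u = inj₁ u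
  ... | inj₂ y = inj₂ (remQuot {m} 2 y)
  a' : Fin N ⊎ (Fin m × Fin 2) → Fin N ⊎ (Fin m × Fin 2) → Bool
  a' (inj₁ u) (inj₁ v) = Ê u v
  a' (inj₁ u) (inj₂ (j , r)) = endpoint j r ==ᶠ u
  a' (inj₂ (j , r)) (inj₁ u) = endpoint j r ==ᶠ u
  a' (inj₂ (j , r)) (inj₂ (j' , r')) = (j ==ᶠ j') ∧ not (r ==ᶠ r')
  a : Fin (N ℕ.+ m * 2) → Fin (N ℕ.+ m * 2) → Bool
  a x y = a' (cls x) (cls y)

is4 : (H : Graph) → Fin (n H) → Bool
is4 H x = ⌊ deg H x ℕ.≟ 4 ⌋

-- The ordering w₁,…,w₄ of the neighbours of a degree-4 vertex x matters only
-- through the split {w₁,w₂} | {w₃,w₄}; side x y = true means y ∈ {w₁,w₂}.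
ValidSide : (H : Graph) → (Fin (n H) → Fin (n H) → Bool) → Set
ValidSide H side = ∀ x → deg H x ≡ 4 → countF (λ y → adj H x y ∧ side x y) ≡ 2

-- vertices of R⁽²⁾(H): (x,0) for every x (for a degree-4 vertex this is x_a),
-- and (x,1) = x_b, (x,2) = x_c for degree-4 vertices x.
R2V : (H : Graph) → Set
R2V H = Σ[ p ∈ (Fin (n H) × Fin 3) ] T ((proj₂ p ==ᶠ zero) ∨ is4 H (proj₁ p))

pathAdj : Fin 3 → Fin 3 → Bool
pathAdj zero (suc zero) = true
pathAdj (suc zero) zero = true
pathAdj (suc zero) (suc (suc zero)) = true
pathAdj (suc (suc zero)) (suc zero) = true
pathAdj _ _ = false

R2adj : (H : Graph) → (Fin (n H) → Fin (n H) → Bool) → R2V H → R2V H → Bool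
R2adj H side ((x , i) , _) ((y , j) , _) =
  (adj H x y ∧ (i ==ᶠ port x y) ∧ (j ==ᶠ port y x)) ∨
  ((x ==ᶠ y) ∧ is4 H x ∧ pathAdj i j)
  where
  port : Fin (n H) → Fin (n H) → Fin 3
  port u v = if is4 H u then (if side u v then zero else suc (suc zero)) else zero

IsoR2 : (G H : Graph) → (Fin (n H) → Fin (n H) → Bool) → Set
IsoR2 G H side = Σ[ f ∈ (Fin (n G) ↔ R2V H) ]
  (∀ u v → adj G u v ≡ R2adj H side (Inverse.to f u) (Inverse.to f v))

InClass : Graph → Set
InClass G =
  Σ[ G' ∈ Graph ] IsSimple G' × Is4Regular G' ×
  Σ[ Ê ∈ (Fin (n G') → Fin (n G') → Bool) ] ValidHat G' Ê ×
  Σ[ side ∈ (Fin (n (R1 G' Ê)) → Fin (n (R1 G' Ê)) → Bool) ]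
    ValidSide (R1 G' Ê) side × IsoR2 G (R1 G' Ê) side

IsVertexCover : (G : Graph) → (Fin (n G) → Bool) → Set
IsVertexCover G S = ∀ u v → adj G u v ≡ true → (S u ≡ true) ⊎ (S v ≡ true)

-- U = R⁽³⁾(G) identified with the edge list; clusterings

E : (G : Graph) → List (Fin (n G) × Fin (n G))
E G = edgeList (adj G)

nE : Graph → ℕ
nE G = length (E G)

Clustering : Graph → ℕ → Set
Clustering G k = Σ[ cl ∈ (Fin (nE G) → Fin k) ] (∀ c → ∃[ p ] cl p ≡ c)

module _ (G : Graph) (k : ℕ) (C : Clustering G k) where
  private cl = proj₁ C

  incident : Fin (nE G) → Fin (n G) → Bool
  incident p i = (proj₁ (lookup (E G) p) ==ᶠ i) ∨ (proj₂ (lookup (E G) p) ==ᶠ i)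

  size : Fin k → ℕ
  size c = countF (λ p → cl p ==ᶠ c)

  -- coordinate i of w = Σ_{v ∈ cluster c} v
  wvec : Fin k → Fin (n G) → ℕ
  wvec c i = countF (λ p → (cl p ==ᶠ c) ∧ incident p i)

  ‖w‖ : Fin k → ℕ
  ‖w‖ c = sumF (n G) (wvec c)

  -- I_Ent(cluster c) = log₂ (impNum c / impDen c), since
  -- Σ_i w_i log(‖w‖/w_i) = log (‖w‖^‖w‖ / Π_i w_i^{w_i})  (0^0 = 1 ↔ zero terms omitted)
  impNum : Fin k → ℕ
  impNum c = ‖w‖ c ^ ‖w‖ c

  impDen : Fin k → ℕ
  impDen c = prodF (n G) (λ i → wvec c i ^ wvec c i)

  -- total impurity = log₂ (totNum / totDen)
  totNum : ℕ
  totNum = prodF k impNum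

  totDen : ℕ
  totDen = prodF k impDen

  hasVertexOfDeg : Fin k → ℕ → Bool
  hasVertexOfDeg c p = not ⌊ countF (λ i → ⌊ wvec c i ℕ.≟ p ⌋) ℕ.≟ 0 ⌋

  isStar : ℕ → Fin k → Bool
  isStar p c = ⌊ size c ℕ.≟ p ⌋ ∧ hasVertexOfDeg c p

  isSingleEdge : Fin k → Bool
  isSingleEdge c = ⌊ size c ℕ.≟ 1 ⌋

  isDisjointPair : Fin k → Bool
  isDisjointPair c = ⌊ size c ℕ.≟ 2 ⌋ ∧ not (hasVertexOfDeg c 2)

  inEGroup : Fin k → Bool
  inEGroup c = not (isStar 3 c) ∧ not (isStar 2 c) ∧ not (isSingleEdge c) ∧ not (isDisjointPair c)

  -- e, q, and the e-group impurity Σ = log₂ (eNum / eDen)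
  eCount : ℕ
  eCount = countF inEGroup

  qCount : ℕ
  qCount = sumF k (λ c → if inEGroup c then size c else 0)

  eNum : ℕ
  eNum = prodF k (λ c → if inEGroup c then impNum c else 1)

  eDen : ℕ
  eDen = prodF k (λ c → if inEGroup c then impDen c else 1)

-- C has minimum total impurity among k-clusterings:
-- log(N/D) ≤ log(N'/D')  ⇔  N·D' ≤ N'·D   (all quantities positive)
IsOptimal : (G : Graph) (k : ℕ) → Clustering G k → Set
IsOptimal G k C = ∀ (C' : Clustering G k) → totNum G k C * totDen G k C' ≤ totNum G k C' * totDen G k C

Fin′ : Graph → Set
Fin′ G = Fin (n G) → Bool

-- Only the shape of G matters. R⁽¹⁾ of a
-- 4-regular graph is triangle-free of maximum degree 4 (Ê is bipartite and every other edge is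
-- subdivided twice), and R⁽²⁾ turns it into a triangle-free graph G of maximum degree 3.
-- A cluster with s edges puts loads w_i ≤ 3 with Σ w_i = 2s on the vertices of G, and its impurity is
-- log₂ ((2s)^(2s) / Π w_i^w_i). An e-group cluster has s ≥ 3 and is no 3-star when s = 3. Since G is
-- triangle-free, three of its edges cover at least four vertices, and a vertex of load 3 together with
-- a fourth edge forces five covered vertices; as w^w ≤ 4^(w−1) for 1 ≤ w ≤ 2 and (w^w)² ≤ 27^(w−1) for
-- 1 ≤ w ≤ 3, this bounds Π w_i^w_i well enough when s ≤ 6, while w^w ≤ 3^w suffices when s ≥ 7.
-- Either way the impurity is at least 16 (s − 3) + (4 − s)(2 + 6 log₂ 3), which is linear in s, so
-- summing over the e-group gives the claim.

module Submission where

open import Defs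
open import Data.Bool using (Bool; true; false; _∧_; _∨_; not; if_then_else_; T)
open import Data.Bool.Properties
  using (∧-conicalˡ; ∧-conicalʳ; ∧-zeroʳ; ∧-identityʳ; ∨-identityʳ; ∨-zeroʳ; not-injective; not-¬;
         T-≡; T-not-≡; T-irrelevant)
open import Data.Empty using (⊥; ⊥-elim)
open import Data.Fin as F using (Fin; zero; suc; splitAt; remQuot; join; combine)
import Data.Fin.Properties as FinP
open import Data.Integer using (+_)
open import Data.List using (List; []; _∷_; length; allFin; lookup; filterᵇ; cartesianProduct)
open import Data.List.Properties using (map-tabulate)
open import Data.List.Membership.Propositional using (_∈_)
open import Data.List.Membership.Propositional.Properties using (∈-lookup; ∈-filter⁻)
open import Data.List.Relation.Unary.All as All using (All; []; _∷_)
open import Data.List.Relation.Unary.AllPairs using ([]; _∷_)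
open import Data.List.Relation.Unary.Unique.Propositional using (Unique)
import Data.List.Relation.Unary.Unique.Propositional.Properties as Unique
open import Data.Nat as ℕ using (ℕ; zero; suc; _+_; _*_; _^_; _≤_; _<_; _∸_; z≤n; s≤s; _≤ᵇ_)
open import Data.Nat.ListAction using (sum; product)
open import Data.Nat.Properties
open import Data.Nat.Tactic.RingSolver using (solve-∀)
open import Data.Product using (∃; ∃-syntax; _×_; _,_; proj₁; proj₂)
open import Data.Product.Properties using (Σ-≡,≡→≡)
open import Data.Rational using (ℚ; _/_; Positive; 1ℚ) renaming (_≤_ to _≤ℚ_; _*_ to _*ℚ_; _+_ to _+ℚ_)
open import Data.Sum using (_⊎_; inj₁; inj₂; [_,_]′)
open import Data.Unit using (tt)
open import Function using (id; _∘_; _∘′_)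
open import Function.Bundles using (Inverse; Injection; Equivalence)
open import Function.Properties.Inverse using (Inverse⇒Injection)
open import Relation.Binary.PropositionalEquality
open import Relation.Nullary using (¬_; Dec; yes; no; contradiction)
open import Relation.Nullary.Decidable
  using (⌊_⌋; T?; toWitness; toWitnessFalse; isYes≗does; dec-true; dec-false)

∧-intro : ∀ {a b} → a ≡ true → b ≡ true → a ∧ b ≡ true
∧-intro refl refl = refl

not-true⇒false : ∀ {a} → not a ≡ true → a ≡ false
not-true⇒false {false} _ = refl

false⇒not-true : ∀ {a} → a ≡ false → not a ≡ true
false⇒not-true refl = refl

isYes-true⇒ : ∀ {A : Set} (a? : Dec A) → ⌊ a? ⌋ ≡ true → A
isYes-true⇒ a? = toWitness {a? = a?} ∘ Equivalence.from T-≡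

isYes-false⇒¬ : ∀ {A : Set} (a? : Dec A) → ⌊ a? ⌋ ≡ false → ¬ A
isYes-false⇒¬ a? = toWitnessFalse {a? = a?} ∘ Equivalence.from T-not-≡

isYes-true : ∀ {A : Set} (a? : Dec A) → A → ⌊ a? ⌋ ≡ true
isYes-true a? a = trans (isYes≗does a?) (dec-true a? a)

isYes-false : ∀ {A : Set} (a? : Dec A) → ¬ A → ⌊ a? ⌋ ≡ false
isYes-false a? ¬a = trans (isYes≗does a?) (dec-false a? ¬a)

no-three-distinct-Bools : ∀ (a b c : Bool) → a ≢ b → b ≢ c → a ≢ c → ⊥
no-three-distinct-Bools true  true  _     a≢b _   _   = a≢b refl
no-three-distinct-Bools false false _     a≢b _   _   = a≢b refl
no-three-distinct-Bools true  false true  _   _   a≢c = a≢c refl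
no-three-distinct-Bools true  false false _   b≢c _   = b≢c refl
no-three-distinct-Bools false true  true  _   b≢c _   = b≢c refl
no-three-distinct-Bools false true  false _   _   a≢c = a≢c refl

==ᶠ-refl : ∀ {n} (i : Fin n) → (i ==ᶠ i) ≡ true
==ᶠ-refl i = isYes-true (i F.≟ i) refl

≢⇒==ᶠ-false : ∀ {n} {i j : Fin n} → i ≢ j → (i ==ᶠ j) ≡ false
≢⇒==ᶠ-false {i = i} {j} = isYes-false (i F.≟ j)

==ᶠ-true⇒≡ : ∀ {n} {i j : Fin n} → (i ==ᶠ j) ≡ true → i ≡ j
==ᶠ-true⇒≡ {i = i} {j} = isYes-true⇒ (i F.≟ j)

==ᶠ-false⇒≢ : ∀ {n} {i j : Fin n} → (i ==ᶠ j) ≡ false → i ≢ j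
==ᶠ-false⇒≢ {i = i} {j} = isYes-false⇒¬ (i F.≟ j)

==ᶠ-sym : ∀ {n} (i j : Fin n) → (i ==ᶠ j) ≡ (j ==ᶠ i)
==ᶠ-sym i j with i F.≟ j
... | yes refl = sym (==ᶠ-refl i)
... | no i≢j = sym (≢⇒==ᶠ-false (i≢j ∘ sym))

nonzero : ℕ → Bool
nonzero x = not ⌊ x ℕ.≟ 0 ⌋

indicator : Bool → ℕ
indicator b = if b then 1 else 0

sumF-suc : ∀ n (f : Fin (suc n) → ℕ) → sumF (suc n) f ≡ f zero + sumF n (f ∘ suc)
sumF-suc n f = cong (λ xs → f zero + sum xs)
  (trans (map-tabulate suc f) (sym (map-tabulate id (f ∘ suc))))

prodF-suc : ∀ n (f : Fin (suc n) → ℕ) → prodF (suc n) f ≡ f zero * prodF n (f ∘ suc)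
prodF-suc n f = cong (λ xs → f zero * product xs)
  (trans (map-tabulate suc f) (sym (map-tabulate id (f ∘ suc))))

countF-suc : ∀ n (f : Fin (suc n) → Bool) → countF f ≡ indicator (f zero) + countF (f ∘ suc)
countF-suc n f = sumF-suc n (indicator ∘ f)

sumF-cong : ∀ n {f g : Fin n → ℕ} → (∀ i → f i ≡ g i) → sumF n f ≡ sumF n g
sumF-cong zero    f≗g = refl
sumF-cong (suc n) {f} {g} f≗g = begin
  sumF (suc n) f             ≡⟨ sumF-suc n f ⟩
  f zero + sumF n (f ∘ suc)  ≡⟨ cong₂ _+_ (f≗g zero) (sumF-cong n (f≗g ∘ suc)) ⟩
  g zero + sumF n (g ∘ suc)  ≡⟨ sumF-suc n g ⟨
  sumF (suc n) g             ∎
  where open ≡-Reasoning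

prodF-cong : ∀ n {f g : Fin n → ℕ} → (∀ i → f i ≡ g i) → prodF n f ≡ prodF n g
prodF-cong zero    f≗g = refl
prodF-cong (suc n) {f} {g} f≗g = begin
  prodF (suc n) f             ≡⟨ prodF-suc n f ⟩
  f zero * prodF n (f ∘ suc)  ≡⟨ cong₂ _*_ (f≗g zero) (prodF-cong n (f≗g ∘ suc)) ⟩
  g zero * prodF n (g ∘ suc)  ≡⟨ prodF-suc n g ⟨
  prodF (suc n) g             ∎
  where open ≡-Reasoning

countF-cong : ∀ {n} {f g : Fin n → Bool} → (∀ i → f i ≡ g i) → countF f ≡ countF g
countF-cong {n} f≗g = sumF-cong n (cong indicator ∘ f≗g)

prodF-mono-≤ : ∀ n {f g : Fin n → ℕ} → (∀ i → f i ≤ g i) → prodF n f ≤ prodF n g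
prodF-mono-≤ zero    _ = ≤-refl
prodF-mono-≤ (suc n) {f} {g} f≤g rewrite prodF-suc n f | prodF-suc n g =
  *-mono-≤ (f≤g zero) (prodF-mono-≤ n (f≤g ∘ suc))

sumF-distrib-+ : ∀ n (f g : Fin n → ℕ) → sumF n (λ i → f i + g i) ≡ sumF n f + sumF n g
sumF-distrib-+ zero    f g = refl
sumF-distrib-+ (suc n) f g
  rewrite sumF-suc n (λ i → f i + g i) | sumF-suc n f | sumF-suc n g
        | sumF-distrib-+ n (f ∘ suc) (g ∘ suc) = +-medial (f zero) (g zero) _ _
  where +-medial : ∀ a b c d → (a + b) + (c + d) ≡ (a + c) + (b + d)
        +-medial = solve-∀

sumF-distribˡ-* : ∀ n a (f : Fin n → ℕ) → sumF n (λ i → a * f i) ≡ a * sumF n f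
sumF-distribˡ-* zero    a f = sym (*-zeroʳ a)
sumF-distribˡ-* (suc n) a f rewrite sumF-suc n (λ i → a * f i) | sumF-suc n f
  | sumF-distribˡ-* n a (f ∘ suc) = sym (*-distribˡ-+ a (f zero) _)

prodF-distrib-* : ∀ n (f g : Fin n → ℕ) → prodF n (λ i → f i * g i) ≡ prodF n f * prodF n g
prodF-distrib-* zero    f g = refl
prodF-distrib-* (suc n) f g
  rewrite prodF-suc n (λ i → f i * g i) | prodF-suc n f | prodF-suc n g
        | prodF-distrib-* n (f ∘ suc) (g ∘ suc) = *-medial (f zero) (g zero) _ _
  where *-medial : ∀ a b c d → (a * b) * (c * d) ≡ (a * c) * (b * d)
        *-medial = solve-∀

prodF-^ : ∀ n a (f : Fin n → ℕ) → prodF n (λ i → a ^ f i) ≡ a ^ sumF n f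
prodF-^ zero    a f = refl
prodF-^ (suc n) a f rewrite prodF-suc n (λ i → a ^ f i) | sumF-suc n f
  | prodF-^ n a (f ∘ suc) = sym (^-distribˡ-+-* a (f zero) _)

sumF-comm : ∀ m n (f : Fin m → Fin n → ℕ) →
  sumF n (λ j → sumF m (λ i → f i j)) ≡ sumF m (λ i → sumF n (f i))
sumF-comm zero    n f = sumF-zero n
  where sumF-zero : ∀ n → sumF n (λ _ → 0) ≡ 0
        sumF-zero zero    = refl
        sumF-zero (suc n) = trans (sumF-suc n (λ _ → 0)) (sumF-zero n)
sumF-comm (suc m) n f = begin
  sumF n (λ j → sumF (suc m) (λ i → f i j))
    ≡⟨ sumF-cong n (λ j → sumF-suc m (λ i → f i j)) ⟩
  sumF n (λ j → f zero j + sumF m (λ i → f (suc i) j))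
    ≡⟨ sumF-distrib-+ n (f zero) _ ⟩
  sumF n (f zero) + sumF n (λ j → sumF m (λ i → f (suc i) j))
    ≡⟨ cong (λ t → sumF n (f zero) + t) (sumF-comm m n (f ∘ suc)) ⟩
  sumF n (f zero) + sumF m (λ i → sumF n (f (suc i)))
    ≡⟨ sumF-suc m _ ⟨
  sumF (suc m) (λ i → sumF n (f i)) ∎
  where open ≡-Reasoning

countF-const : ∀ n b → countF {n} (λ _ → b) ≡ n * indicator b
countF-const zero    b = refl
countF-const (suc n) b = trans (countF-suc n (λ _ → b)) (cong (λ t → indicator b + t) (countF-const n b))

suc-==ᶠ : ∀ {n} (i j : Fin n) → (suc i ==ᶠ suc j) ≡ (i ==ᶠ j)
suc-==ᶠ i j with i ==ᶠ j in i==j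
... | true rewrite ==ᶠ-true⇒≡ i==j = ==ᶠ-refl (suc j)
... | false = ≢⇒==ᶠ-false (==ᶠ-false⇒≢ i==j ∘ FinP.suc-injective)

countF-==ᶠ : ∀ {n} (j : Fin n) → countF (_==ᶠ j) ≡ 1
countF-==ᶠ {suc n} zero = begin
  countF {suc n} (_==ᶠ zero)
    ≡⟨ countF-suc n (_==ᶠ zero) ⟩
  1 + countF {n} (λ i → suc i ==ᶠ zero)
    ≡⟨ cong suc (countF-cong {n} {g = λ _ → false} (λ i → ≢⇒==ᶠ-false {i = suc i} {zero} λ ())) ⟩
  1 + countF {n} (λ _ → false)
    ≡⟨ cong suc (countF-const n false) ⟩
  1 + n * 0
    ≡⟨ cong suc (*-zeroʳ n) ⟩
  1 ∎
  where open ≡-Reasoning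
countF-==ᶠ {suc n} (suc j) = begin
  countF {suc n} (_==ᶠ suc j)             ≡⟨ countF-suc n (_==ᶠ suc j) ⟩
  0 + countF {n} (λ i → suc i ==ᶠ suc j)  ≡⟨ countF-cong (λ i → suc-==ᶠ i j) ⟩
  countF (_==ᶠ j)                         ≡⟨ countF-==ᶠ j ⟩
  1                                       ∎
  where open ≡-Reasoning

countF-split : ∀ {n} (f g : Fin n → Bool) →
  countF f ≡ countF (λ i → f i ∧ g i) + countF (λ i → f i ∧ not (g i))
countF-split {zero}  f g = refl
countF-split {suc n} f g
  rewrite countF-suc n f | countF-suc n (λ i → f i ∧ g i) | countF-suc n (λ i → f i ∧ not (g i))
        | countF-split (f ∘ suc) (g ∘ suc)
  with f zero | g zero
... | true  | true  = refl
... | true  | false = sym (+-suc _ _)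
... | false | _     = refl

countF-remove : ∀ {n} (f : Fin n → Bool) j → f j ≡ true →
  countF f ≡ suc (countF (λ i → f i ∧ not (i ==ᶠ j)))
countF-remove f j fj = trans (countF-split f (_==ᶠ j))
  (cong (_+ countF (λ i → f i ∧ not (i ==ᶠ j))) (trans (countF-cong f∧==j) (countF-==ᶠ j)))
  where
  f∧==j : ∀ i → (f i ∧ (i ==ᶠ j)) ≡ (i ==ᶠ j)
  f∧==j i with i ==ᶠ j in i==j
  ... | true rewrite ==ᶠ-true⇒≡ i==j | fj = refl
  ... | false = ∧-zeroʳ (f i)

countF≡0⇒false : ∀ {n} (f : Fin n → Bool) → countF f ≡ 0 → ∀ i → f i ≡ false
countF≡0⇒false f count≡0 i with f i in fi
... | true  = contradiction (trans (sym (countF-remove f i fi)) count≡0) λ ()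
... | false = refl

countF-positive : ∀ {n} (f : Fin n → Bool) → 1 ≤ countF f → ∃[ i ] f i ≡ true
countF-positive {suc n} f 1≤count with f zero in f0 | countF-suc n f
... | true  | _  = zero , f0
... | false | eq = let i , fi = countF-positive (f ∘ suc) (subst (1 ≤_) eq 1≤count) in suc i , fi

countF-injection : ∀ {a b} (f : Fin a → Bool) (g : Fin b → Bool) (h : Fin a → Fin b) →
  (∀ i → f i ≡ true → g (h i) ≡ true) →
  (∀ i j → f i ≡ true → f j ≡ true → h i ≡ h j → i ≡ j) →
  countF f ≤ countF g
countF-injection {zero}  f g h _ _ = z≤n
countF-injection {suc a} f g h maps inj rewrite countF-suc a f with f zero in f0
... | false = countF-injection (f ∘ suc) g (h ∘ suc) (maps ∘ suc)
                (λ i j fi fj → FinP.suc-injective ∘ inj (suc i) (suc j) fi fj)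
... | true rewrite countF-remove g (h zero) (maps zero f0) =
  s≤s (countF-injection (f ∘ suc) (λ i → g i ∧ not (i ==ᶠ h zero)) (h ∘ suc)
        (λ i fi → ∧-intro (maps (suc i) fi)
           (false⇒not-true (≢⇒==ᶠ-false λ hi≡h0 → 0≢suc (inj (suc i) zero fi f0 hi≡h0))))
        (λ i j fi fj → FinP.suc-injective ∘ inj (suc i) (suc j) fi fj))
  where
  0≢suc : ∀ {i : Fin a} → suc i ≢ zero
  0≢suc ()

lookup-injective : ∀ {A : Set} {xs : List A} → Unique xs → ∀ i j → lookup xs i ≡ lookup xs j → i ≡ j
lookup-injective (_ ∷ _)        zero    zero    _  = refl
lookup-injective (x∉xs ∷ _)     zero    (suc j) eq = contradiction eq (All.lookup x∉xs (∈-lookup j))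
lookup-injective (x∉xs ∷ _)     (suc i) zero    eq = contradiction (sym eq) (All.lookup x∉xs (∈-lookup i))
lookup-injective (_ ∷ unique)   (suc i) (suc j) eq = cong suc (lookup-injective unique i j eq)

length≤countF : ∀ {n} (f : Fin n → Bool) (xs : List (Fin n)) → Unique xs → All (λ i → f i ≡ true) xs →
  length xs ≤ countF f
length≤countF f xs unique all = subst (_≤ countF f) (trans (countF-const (length xs) true) (*-identityʳ _))
  (countF-injection (λ _ → true) f (lookup xs) (λ p _ → All.lookup all (∈-lookup p))
    (λ p q _ _ → lookup-injective unique p q))

countF-pick : ∀ {n} (f : Fin n → Bool) k → suc k ≤ countF f →
  ∃[ i ] (f i ≡ true × k ≤ countF (λ j → f j ∧ not (j ==ᶠ i)))
countF-pick f k k<count with i , fi ← countF-positive f (≤-trans (s≤s z≤n) k<count)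
  = i , fi , ≤-pred (subst (suc k ≤_) (countF-remove f i fi) k<count)

record ThreeDistinct {n} (f : Fin n → Bool) : Set where
  constructor threeDistinct
  field
    x₁ x₂ x₃ : Fin n
    f-x₁ : f x₁ ≡ true
    f-x₂ : f x₂ ≡ true
    f-x₃ : f x₃ ≡ true
    x₁≢x₂ : x₁ ≢ x₂
    x₁≢x₃ : x₁ ≢ x₃
    x₂≢x₃ : x₂ ≢ x₃

threeDistinct-from-countF : ∀ {n} (f : Fin n → Bool) → 3 ≤ countF f → ThreeDistinct f
threeDistinct-from-countF f 3≤count
  with i , fi , 2≤rest ← countF-pick f 2 3≤count
  with j , fj , 1≤rest ← countF-pick (λ x → f x ∧ not (x ==ᶠ i)) 1 2≤rest
  with l , fl , _      ← countF-pick (λ x → (f x ∧ not (x ==ᶠ i)) ∧ not (x ==ᶠ j)) 0 1≤rest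
  = threeDistinct i j l fi (∧-conicalˡ _ _ fj) (∧-conicalˡ (f l) _ (∧-conicalˡ _ _ fl))
      (λ i≡j → ==ᶠ-false⇒≢ (not-true⇒false (∧-conicalʳ _ _ fj)) (sym i≡j))
      (λ i≡l → ==ᶠ-false⇒≢ (not-true⇒false (∧-conicalʳ (f l) _ (∧-conicalˡ _ _ fl))) (sym i≡l))
      (λ j≡l → ==ᶠ-false⇒≢ (not-true⇒false (∧-conicalʳ _ _ fl)) (sym j≡l))

prodF-*-^-^ : ∀ k (f : Fin k → ℕ) a (g : Fin k → ℕ) x (h : Fin k → ℕ) →
  prodF k (λ c → f c * a ^ g c * x ^ h c) ≡ prodF k f * a ^ sumF k g * x ^ sumF k h
prodF-*-^-^ k f a g x h = begin
  prodF k (λ c → f c * a ^ g c * x ^ h c)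
    ≡⟨ prodF-distrib-* k (λ c → f c * a ^ g c) (λ c → x ^ h c) ⟩
  prodF k (λ c → f c * a ^ g c) * prodF k (λ c → x ^ h c)
    ≡⟨ cong₂ _*_ (prodF-distrib-* k f (λ c → a ^ g c)) (prodF-^ k x h) ⟩
  prodF k f * prodF k (λ c → a ^ g c) * x ^ sumF k h
    ≡⟨ cong (λ t → prodF k f * t * x ^ sumF k h) (prodF-^ k a g) ⟩
  prodF k f * a ^ sumF k g * x ^ sumF k h ∎
  where open ≡-Reasoning

sumF-if-const : ∀ k (b : Fin k → Bool) m → sumF k (λ c → if b c then m else 0) ≡ m * countF b
sumF-if-const k b m = trans (sumF-cong k (λ c → if-const (b c))) (sumF-distribˡ-* k m (indicator ∘′ b))
  where
  if-const : ∀ b → (if b then m else 0) ≡ m * indicator b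
  if-const true  = sym (*-identityʳ m)
  if-const false = sym (*-zeroʳ m)

SymmetricAdj : Graph → Set
SymmetricAdj G = ∀ u v → adj G u v ≡ adj G v u

Loopless : Graph → Set
Loopless G = ∀ u → adj G u u ≡ false

TriangleFree : Graph → Set
TriangleFree G = ∀ a b c → adj G a b ≡ true → adj G b c ≡ true → adj G a c ≡ true → ⊥

MaxDegree : ℕ → Graph → Set
MaxDegree d G = ∀ u → deg G u ≤ d

<ᶠ-true⇒< : ∀ {m} {i j : Fin m} → (i <ᶠ j) ≡ true → i F.< j
<ᶠ-true⇒< {i = i} {j} _ with i F.<? j
<ᶠ-true⇒< _  | yes i<j = i<j
<ᶠ-true⇒< () | no _

∈-filterᵇ⁻ : ∀ {A : Set} (P : A → Bool) (xs : List A) {x} → x ∈ filterᵇ P xs → x ∈ xs × P x ≡ true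
∈-filterᵇ⁻ P xs x∈ with x∈xs , Px ← ∈-filter⁻ (T? ∘ P) {xs = xs} x∈ = x∈xs , Equivalence.to T-≡ Px

filterᵇ-unique : ∀ {A : Set} (P : A → Bool) {xs : List A} → Unique xs → Unique (filterᵇ P xs)
filterᵇ-unique P = Unique.filter⁺ (T? ∘ P)

∈-edgeList⁻ : ∀ {m} (a : Fin m → Fin m → Bool) {u v} → (u , v) ∈ edgeList a → u F.< v × a u v ≡ true
∈-edgeList⁻ {m} a uv∈
  with _ , u<v∧a ← ∈-filterᵇ⁻ (λ p → (proj₁ p <ᶠ proj₂ p) ∧ a (proj₁ p) (proj₂ p))
                               (cartesianProduct (allFin m) (allFin m)) uv∈
  = <ᶠ-true⇒< (∧-conicalˡ _ _ u<v∧a) , ∧-conicalʳ _ _ u<v∧a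

edgeList-unique : ∀ {m} (a : Fin m → Fin m → Bool) → Unique (edgeList a)
edgeList-unique {m} a = filterᵇ-unique (λ p → (proj₁ p <ᶠ proj₂ p) ∧ a (proj₁ p) (proj₂ p))
  (Unique.cartesianProduct⁺ (Unique.allFin⁺ m) (Unique.allFin⁺ m))

-- R⁽¹⁾: subdividing the edges outside Ê

module Subdivision (G' : Graph) (Ê : Fin (n G') → Fin (n G') → Bool)
                   (simple : IsSimple G') (regular : Is4Regular G') (valid : ValidHat G' Ê) where

  private
    N = n G'
    L = nonHat G' Ê
    m = length L

    Ê-sym : ∀ u v → Ê u v ≡ Ê v u
    Ê-sym = proj₁ valid

    Ê⊆adj : ∀ u v → Ê u v ≡ true → adj G' u v ≡ true
    Ê⊆adj = proj₁ (proj₂ valid)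

    colour : Fin N → Bool
    colour = proj₁ (proj₂ (proj₂ (proj₂ valid)))

    colour-proper : ∀ u v → Ê u v ≡ true → colour u ≢ colour v
    colour-proper = proj₂ (proj₂ (proj₂ (proj₂ valid)))

  -- `classify` and `link` restate the local `cls` and `a'` of R1 in Defs
  Vertex : Set
  Vertex = Fin N ⊎ (Fin m × Fin 2)

  classify : Fin (n (R1 G' Ê)) → Vertex
  classify x = [ inj₁ , inj₂ ∘ remQuot 2 ]′ (splitAt N x)

  classify-injective : ∀ {x y} → classify x ≡ classify y → x ≡ y
  classify-injective {x} {y} eq =
    trans (sym (unclassify∘classify x)) (trans (cong unclassify eq) (unclassify∘classify y))
    where
    unclassify : Vertex → Fin (n (R1 G' Ê))
    unclassify (inj₁ u)       = join N (m * 2) (inj₁ u)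
    unclassify (inj₂ (j , r)) = join N (m * 2) (inj₂ (combine j r))
    unclassify∘classify : ∀ x → unclassify (classify x) ≡ x
    unclassify∘classify x with splitAt N x in eq
    ... | inj₁ u = trans (cong (join N (m * 2)) (sym eq)) (FinP.join-splitAt N (m * 2) x)
    ... | inj₂ z = trans (cong (λ t → join N (m * 2) (inj₂ t)) (FinP.combine-remQuot {m} 2 z))
                         (trans (cong (join N (m * 2)) (sym eq)) (FinP.join-splitAt N (m * 2) x))

  endpoint : Fin m → Fin 2 → Fin N
  endpoint j zero    = proj₁ (lookup L j)
  endpoint j (suc _) = proj₂ (lookup L j)

  flip : Fin 2 → Fin 2
  flip zero    = suc zero
  flip (suc _) = zero

  link : Vertex → Vertex → Bool
  link (inj₁ u)       (inj₁ v)         = Ê u v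
  link (inj₁ u)       (inj₂ (j , r))   = endpoint j r ==ᶠ u
  link (inj₂ (j , r)) (inj₁ u)         = endpoint j r ==ᶠ u
  link (inj₂ (j , r)) (inj₂ (j' , r')) = (j ==ᶠ j') ∧ not (r ==ᶠ r')

  adj-R1≡link : ∀ x y → adj (R1 G' Ê) x y ≡ link (classify x) (classify y)
  adj-R1≡link x y with splitAt N x | splitAt N y
  ... | inj₁ u | inj₁ v = refl
  ... | inj₁ u | inj₂ z with F.quotRem {m} 2 z
  ...   | zero     , j = refl
  ...   | suc zero , j = refl
  adj-R1≡link x y | inj₂ z | inj₁ v with F.quotRem {m} 2 z
  ...   | zero     , j = refl
  ...   | suc zero , j = refl
  adj-R1≡link x y | inj₂ z | inj₂ z' with F.quotRem {m} 2 z | F.quotRem {m} 2 z'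
  ...   | zero     , j | zero     , j' = refl
  ...   | zero     , j | suc zero , j' = refl
  ...   | suc zero , j | zero     , j' = refl
  ...   | suc zero , j | suc zero , j' = refl

  private
    nonHat-edge : ∀ j → lookup L j ∈ edgeList (adj G') × not (Ê (endpoint j zero) (endpoint j (suc zero))) ≡ true
    nonHat-edge j = ∈-filterᵇ⁻ (λ p → not (Ê (proj₁ p) (proj₂ p))) (edgeList (adj G')) (∈-lookup j)

  endpoint-< : ∀ j → endpoint j zero F.< endpoint j (suc zero)
  endpoint-< j = proj₁ (∈-edgeList⁻ (adj G') (proj₁ (nonHat-edge j)))

  private
    endpoint-adj₀ : ∀ j → adj G' (endpoint j zero) (endpoint j (suc zero)) ≡ true
    endpoint-adj₀ j = proj₂ (∈-edgeList⁻ (adj G') (proj₁ (nonHat-edge j)))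

    endpoint-not-hat₀ : ∀ j → Ê (endpoint j zero) (endpoint j (suc zero)) ≡ false
    endpoint-not-hat₀ j = not-true⇒false (proj₂ (nonHat-edge j))

  endpoint-flip : ∀ j r → endpoint j (flip r) ≢ endpoint j r
  endpoint-flip j zero       eq = FinP.<-irrefl (sym eq) (endpoint-< j)
  endpoint-flip j (suc zero) eq = FinP.<-irrefl eq (endpoint-< j)

  flip-unique : ∀ {r r' : Fin 2} → r ≢ r' → r' ≡ flip r
  flip-unique {zero}     {zero}     r≢r' = contradiction refl r≢r'
  flip-unique {zero}     {suc zero} _    = refl
  flip-unique {suc zero} {zero}     _    = refl
  flip-unique {suc zero} {suc zero} r≢r' = contradiction refl r≢r'

  endpoint-injective : ∀ {j₁ j₂ r₁ r₂} → endpoint j₁ r₁ ≡ endpoint j₂ r₂ →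
    endpoint j₁ (flip r₁) ≡ endpoint j₂ (flip r₂) → (j₁ , r₁) ≡ (j₂ , r₂)
  endpoint-injective {j₁} {j₂} {zero} {zero} eq₀ eq₁ =
    cong (_, zero) (lookup-injective (filterᵇ-unique _ (edgeList-unique (adj G'))) j₁ j₂ (cong₂ _,_ eq₀ eq₁))
  endpoint-injective {j₁} {j₂} {suc zero} {suc zero} eq₁ eq₀ =
    cong (_, suc zero) (lookup-injective (filterᵇ-unique _ (edgeList-unique (adj G'))) j₁ j₂ (cong₂ _,_ eq₀ eq₁))
  endpoint-injective {j₁} {j₂} {zero} {suc zero} eq₀ eq₁ = ⊥-elim (FinP.<-asym
    (subst₂ F._<_ eq₀ eq₁ (endpoint-< j₁)) (endpoint-< j₂))
  endpoint-injective {j₁} {j₂} {suc zero} {zero} eq₁ eq₀ = ⊥-elim (FinP.<-asym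
    (subst₂ F._<_ eq₀ eq₁ (endpoint-< j₁)) (endpoint-< j₂))

  subdivision-neighbour : ∀ j r β → link (inj₂ (j , r)) β ≡ true →
    β ≡ inj₁ (endpoint j r) ⊎ β ≡ inj₂ (j , flip r)
  subdivision-neighbour j r (inj₁ u) αβ = inj₁ (cong inj₁ (sym (==ᶠ-true⇒≡ αβ)))
  subdivision-neighbour j r (inj₂ (j' , r')) αβ = inj₂ (cong₂ (λ a b → inj₂ (a , b))
    (sym (==ᶠ-true⇒≡ (∧-conicalˡ _ _ αβ))) (flip-unique (==ᶠ-false⇒≢ (not-true⇒false (∧-conicalʳ _ _ αβ)))))

  Ê-loopless : ∀ u → Ê u u ≡ false
  Ê-loopless u with Ê u u in uu
  ... | true  = ⊥-elim (not-¬ (Ê⊆adj u u uu) (proj₂ simple u))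
  ... | false = refl

  endpoint-adj : ∀ j r → adj G' (endpoint j r) (endpoint j (flip r)) ≡ true
  endpoint-adj j zero       = endpoint-adj₀ j
  endpoint-adj j (suc zero) = trans (proj₁ simple _ _) (endpoint-adj₀ j)

  endpoint-not-hat : ∀ j r → Ê (endpoint j r) (endpoint j (flip r)) ≡ false
  endpoint-not-hat j zero       = endpoint-not-hat₀ j
  endpoint-not-hat j (suc zero) = trans (Ê-sym _ _) (endpoint-not-hat₀ j)

  link-sym : ∀ α β → link α β ≡ link β α
  link-sym (inj₁ u)       (inj₁ v)         = Ê-sym u v
  link-sym (inj₁ _)       (inj₂ _)         = refl
  link-sym (inj₂ _)       (inj₁ _)         = refl
  link-sym (inj₂ (j , r)) (inj₂ (j' , r')) = cong₂ (λ a b → a ∧ not b) (==ᶠ-sym j j') (==ᶠ-sym r r')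

  link-loopless : ∀ α → link α α ≡ false
  link-loopless (inj₁ u) = Ê-loopless u
  link-loopless (inj₂ (j , r)) rewrite ==ᶠ-refl j | ==ᶠ-refl r = refl

  subdivision-in-no-triangle : ∀ j r β γ → link (inj₂ (j , r)) β ≡ true → link (inj₂ (j , r)) γ ≡ true →
    link β γ ≡ true → ⊥
  subdivision-in-no-triangle j r β γ αβ αγ βγ
    with subdivision-neighbour j r β αβ | subdivision-neighbour j r γ αγ
  ... | inj₁ refl | inj₁ refl = not-¬ βγ (link-loopless β)
  ... | inj₂ refl | inj₂ refl = not-¬ βγ (link-loopless β)
  ... | inj₁ refl | inj₂ refl = endpoint-flip j r (==ᶠ-true⇒≡ βγ)
  ... | inj₂ refl | inj₁ refl = endpoint-flip j r (==ᶠ-true⇒≡ βγ)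

  -- Ê is bipartite, and every other edge of G' is subdivided twice.
  link-triangleFree : ∀ α β γ → link α β ≡ true → link β γ ≡ true → link α γ ≡ true → ⊥
  link-triangleFree (inj₂ (j , r)) β γ αβ βγ αγ = subdivision-in-no-triangle j r β γ αβ αγ βγ
  link-triangleFree α (inj₂ (j , r)) γ αβ βγ αγ =
    subdivision-in-no-triangle j r α γ (trans (link-sym _ α) αβ) βγ αγ
  link-triangleFree α β (inj₂ (j , r)) αβ βγ αγ =
    subdivision-in-no-triangle j r α β (trans (link-sym _ α) αγ) (trans (link-sym _ β) βγ) αβ
  link-triangleFree (inj₁ u) (inj₁ v) (inj₁ w) αβ βγ αγ =
    no-three-distinct-Bools (colour u) (colour v) (colour w)
      (colour-proper u v αβ) (colour-proper v w βγ) (colour-proper u w αγ)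

  edge-of-neighbour : Vertex → Fin N
  edge-of-neighbour (inj₁ v)       = v
  edge-of-neighbour (inj₂ (j , r)) = endpoint j (flip r)

  edge-of-neighbour-adj : ∀ u β → link (inj₁ u) β ≡ true → adj G' u (edge-of-neighbour β) ≡ true
  edge-of-neighbour-adj u (inj₁ v)       uv = Ê⊆adj u v uv
  edge-of-neighbour-adj u (inj₂ (j , r)) ur rewrite sym (==ᶠ-true⇒≡ ur) = endpoint-adj j r

  edge-of-neighbour-injective : ∀ u β₁ β₂ → link (inj₁ u) β₁ ≡ true → link (inj₁ u) β₂ ≡ true →
    edge-of-neighbour β₁ ≡ edge-of-neighbour β₂ → β₁ ≡ β₂
  edge-of-neighbour-injective u (inj₁ v₁) (inj₁ v₂) _ _ eq = cong inj₁ eq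
  edge-of-neighbour-injective u (inj₁ v) (inj₂ (j , r)) uv ur refl rewrite sym (==ᶠ-true⇒≡ ur) =
    ⊥-elim (not-¬ uv (endpoint-not-hat j r))
  edge-of-neighbour-injective u (inj₂ (j , r)) (inj₁ v) ur uv refl rewrite sym (==ᶠ-true⇒≡ ur) =
    ⊥-elim (not-¬ uv (endpoint-not-hat j r))
  edge-of-neighbour-injective u (inj₂ (j₁ , r₁)) (inj₂ (j₂ , r₂)) u₁ u₂ eq =
    cong inj₂ (endpoint-injective (trans (==ᶠ-true⇒≡ u₁) (sym (==ᶠ-true⇒≡ u₂))) eq)

  is-subdivision : Vertex → Fin 2
  is-subdivision (inj₁ _) = zero
  is-subdivision (inj₂ _) = suc zero

  is-subdivision-injective : ∀ j r β₁ β₂ → link (inj₂ (j , r)) β₁ ≡ true → link (inj₂ (j , r)) β₂ ≡ true →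
    is-subdivision β₁ ≡ is-subdivision β₂ → β₁ ≡ β₂
  is-subdivision-injective j r β₁ β₂ αβ₁ αβ₂ eq
    with subdivision-neighbour j r β₁ αβ₁ | subdivision-neighbour j r β₂ αβ₂ | eq
  ... | inj₁ refl | inj₁ refl | _ = refl
  ... | inj₂ refl | inj₂ refl | _ = refl
  ... | inj₁ refl | inj₂ refl | ()
  ... | inj₂ refl | inj₁ refl | ()

  link-degree≤4 : ∀ α → countF (λ y → link α (classify y)) ≤ 4
  link-degree≤4 (inj₁ u) = ≤-trans
    (countF-injection _ (adj G' u) (edge-of-neighbour ∘ classify)
      (λ y → edge-of-neighbour-adj u (classify y))
      (λ y₁ y₂ uy₁ uy₂ → classify-injective ∘ edge-of-neighbour-injective u _ _ uy₁ uy₂))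
    (≤-reflexive (regular u))
  link-degree≤4 (inj₂ (j , r)) = ≤-trans
    (countF-injection _ (λ _ → true) (is-subdivision ∘ classify) (λ _ _ → refl)
      (λ y₁ y₂ αy₁ αy₂ → classify-injective ∘ is-subdivision-injective j r _ _ αy₁ αy₂))
    (s≤s (s≤s z≤n))

  private
    link-R1 : ∀ x y → adj (R1 G' Ê) x y ≡ true → link (classify x) (classify y) ≡ true
    link-R1 x y xy = trans (sym (adj-R1≡link x y)) xy

  R1-symmetric : SymmetricAdj (R1 G' Ê)
  R1-symmetric x y = trans (adj-R1≡link x y) (trans (link-sym (classify x) (classify y)) (sym (adj-R1≡link y x)))

  R1-loopless : Loopless (R1 G' Ê)
  R1-loopless x = trans (adj-R1≡link x x) (link-loopless (classify x))

  R1-triangleFree : TriangleFree (R1 G' Ê)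
  R1-triangleFree a b c ab bc ac =
    link-triangleFree (classify a) (classify b) (classify c) (link-R1 a b ab) (link-R1 b c bc) (link-R1 a c ac)

  R1-maxDegree : MaxDegree 4 (R1 G' Ê)
  R1-maxDegree x = ≤-trans (≤-reflexive (countF-cong (adj-R1≡link x))) (link-degree≤4 (classify x))

-- R⁽²⁾: splitting the vertices of degree 4

pathAdj-irrefl : ∀ i → pathAdj i i ≡ false
pathAdj-irrefl zero             = refl
pathAdj-irrefl (suc zero)       = refl
pathAdj-irrefl (suc (suc zero)) = refl

pathAdj-sym : ∀ i j → pathAdj i j ≡ pathAdj j i
pathAdj-sym zero             zero             = refl
pathAdj-sym zero             (suc zero)       = refl
pathAdj-sym zero             (suc (suc zero)) = refl
pathAdj-sym (suc zero)       zero             = refl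
pathAdj-sym (suc zero)       (suc zero)       = refl
pathAdj-sym (suc zero)       (suc (suc zero)) = refl
pathAdj-sym (suc (suc zero)) zero             = refl
pathAdj-sym (suc (suc zero)) (suc zero)       = refl
pathAdj-sym (suc (suc zero)) (suc (suc zero)) = refl

pathAdj-triangleFree : ∀ i j l → pathAdj i j ≡ true → pathAdj j l ≡ true → pathAdj i l ≡ true → ⊥
pathAdj-triangleFree zero             (suc zero) zero             _ _ ()
pathAdj-triangleFree zero             (suc zero) (suc (suc zero)) _ _ ()
pathAdj-triangleFree (suc zero)       zero       (suc zero)       _ _ ()
pathAdj-triangleFree (suc zero)       (suc (suc zero)) (suc zero) _ _ ()
pathAdj-triangleFree (suc (suc zero)) (suc zero) zero             _ _ ()
pathAdj-triangleFree (suc (suc zero)) (suc zero) (suc (suc zero)) _ _ ()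
pathAdj-triangleFree zero             zero             _ ()
pathAdj-triangleFree zero             (suc (suc zero)) _ ()
pathAdj-triangleFree (suc zero)       (suc zero)       _ ()
pathAdj-triangleFree (suc (suc zero)) zero             _ ()
pathAdj-triangleFree (suc (suc zero)) (suc (suc zero)) _ ()

pathAdj⇒≢ : ∀ {i j} → pathAdj i j ≡ true → i ≢ j
pathAdj⇒≢ {i} ij refl = not-¬ ij (pathAdj-irrefl i)

module Splitting (H : Graph) (side : Fin (n H) → Fin (n H) → Bool) (side-valid : ValidSide H side)
                 (H-sym : SymmetricAdj H) (H-loopless : Loopless H) (H-triangleFree : TriangleFree H)
                 (H-maxDegree : MaxDegree 4 H) where

  -- a copy of the `port` local to Defs' R2adj, so that `link` unfolds to R2adj;
  -- (x , i) is joined to (y , j) for an H-edge x y iff i = port x y and j = port y x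
  port : Fin (n H) → Fin (n H) → Fin 3
  port x y = if is4 H x then (if side x y then zero else suc (suc zero)) else zero

  link : Fin (n H) → Fin 3 → Fin (n H) → Fin 3 → Bool
  link x i y j = (adj H x y ∧ (i ==ᶠ port x y) ∧ (j ==ᶠ port y x)) ∨ ((x ==ᶠ y) ∧ is4 H x ∧ pathAdj i j)


  link-same-base : ∀ x i j → link x i x j ≡ true → is4 H x ∧ pathAdj i j ≡ true
  link-same-base x i j h rewrite H-loopless x | ==ᶠ-refl x = h

  link-cross : ∀ x i y j → x ≢ y → link x i y j ≡ true →
    adj H x y ≡ true × i ≡ port x y × j ≡ port y x
  link-cross x i y j x≢y h
    rewrite ≢⇒==ᶠ-false x≢y | ∨-identityʳ (adj H x y ∧ (i ==ᶠ port x y) ∧ (j ==ᶠ port y x)) =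
    ∧-conicalˡ _ _ h ,
    ==ᶠ-true⇒≡ (∧-conicalˡ _ _ (∧-conicalʳ (adj H x y) _ h)) ,
    ==ᶠ-true⇒≡ (∧-conicalʳ _ _ (∧-conicalʳ (adj H x y) _ h))

  link-sym : ∀ x i y j → link x i y j ≡ link y j x i
  link-sym x i y j with x F.≟ y
  ... | yes refl rewrite H-loopless x | ==ᶠ-refl x = cong (is4 H x ∧_) (pathAdj-sym i j)
  ... | no x≢y rewrite ≢⇒==ᶠ-false (x≢y ∘ sym) | H-sym x y =
    cong (_∨ false) (∧-swapʳ (adj H y x) (i ==ᶠ port x y) (j ==ᶠ port y x))
    where
    ∧-swapʳ : ∀ a b c → (a ∧ b ∧ c) ≡ (a ∧ c ∧ b)
    ∧-swapʳ true true  c = sym (∧-identityʳ c)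
    ∧-swapʳ true false c = sym (∧-zeroʳ c)
    ∧-swapʳ false _    _ = refl

  -- a triangle meets at most one path x_a x_b x_c in an edge, since each (x , i) has one port towards y
  link-triangleFree : ∀ x i y j z l → link x i y j ≡ true → link y j z l ≡ true → link x i z l ≡ true → ⊥
  link-triangleFree x i y j z l = by-bases (x F.≟ y) (y F.≟ z) (x F.≟ z)
    where
    by-bases : Dec (x ≡ y) → Dec (y ≡ z) → Dec (x ≡ z) →
      link x i y j ≡ true → link y j z l ≡ true → link x i z l ≡ true → ⊥
    by-bases (yes refl) (yes refl) _ xy yz xz = pathAdj-triangleFree i j l
      (∧-conicalʳ (is4 H x) _ (link-same-base x i j xy)) (∧-conicalʳ (is4 H x) _ (link-same-base x j l yz))
      (∧-conicalʳ (is4 H x) _ (link-same-base x i l xz))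
    by-bases (yes refl) (no x≢z) _ xy yz xz = pathAdj⇒≢ (∧-conicalʳ (is4 H x) _ (link-same-base x i j xy))
      (trans (proj₁ (proj₂ (link-cross x i z l x≢z xz))) (sym (proj₁ (proj₂ (link-cross x j z l x≢z yz)))))
    by-bases (no x≢y) (yes refl) _ xy yz xz = pathAdj⇒≢ (∧-conicalʳ (is4 H y) _ (link-same-base y j l yz))
      (trans (proj₂ (proj₂ (link-cross x i y j x≢y xy))) (sym (proj₂ (proj₂ (link-cross x i y l x≢y xz)))))
    by-bases (no x≢y) (no y≢x) (yes refl) xy yz xz = pathAdj⇒≢ (∧-conicalʳ (is4 H x) _ (link-same-base x i l xz))
      (trans (proj₁ (proj₂ (link-cross x i y j x≢y xy))) (sym (proj₂ (proj₂ (link-cross y j x l y≢x yz)))))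
    by-bases (no x≢y) (no y≢z) (no x≢z) xy yz xz = H-triangleFree x y z
      (proj₁ (link-cross x i y j x≢y xy)) (proj₁ (link-cross y j z l y≢z yz)) (proj₁ (link-cross x i z l x≢z xz))

  path-degree port-degree : Fin (n H) → Fin 3 → ℕ
  path-degree x i = countF (λ j → is4 H x ∧ pathAdj i j)
  port-degree x i = countF (λ y → adj H x y ∧ (i ==ᶠ port x y))

  private
    port-match : ∀ b → Fin 3 → Bool
    port-match b zero             = b
    port-match b (suc zero)       = false
    port-match b (suc (suc zero)) = not b

    ==ᶠ-port : ∀ i b → (i ==ᶠ (if b then zero else suc (suc zero))) ≡ port-match b i
    ==ᶠ-port zero             true  = refl
    ==ᶠ-port zero             false = refl
    ==ᶠ-port (suc zero)       true  = refl
    ==ᶠ-port (suc zero)       false = refl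
    ==ᶠ-port (suc (suc zero)) true  = refl
    ==ᶠ-port (suc (suc zero)) false = refl

    port-of-degree4 : ∀ {x} y → is4 H x ≡ true → port x y ≡ (if side x y then zero else suc (suc zero))
    port-of-degree4 y d4 rewrite d4 = refl

    port-of-other : ∀ {x} y → is4 H x ≡ false → port x y ≡ zero
    port-of-other y d4 rewrite d4 = refl

    port-degree-of-degree4 : ∀ x i → is4 H x ≡ true → port-degree x i ≡ countF (λ y → adj H x y ∧ port-match (side x y) i)
    port-degree-of-degree4 x i d4 = countF-cong λ y →
      cong (adj H x y ∧_) (trans (cong (i ==ᶠ_) (port-of-degree4 y d4)) (==ᶠ-port i (side x y)))

    path-degree-of-degree4 : ∀ x i → is4 H x ≡ true → path-degree x i ≡ countF (pathAdj i)
    path-degree-of-degree4 x i d4 = countF-cong λ j → cong (_∧ pathAdj i j) d4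

  level-degree≤3-of-degree4 : ∀ x i → is4 H x ≡ true → path-degree x i + port-degree x i ≤ 3
  level-degree≤3-of-degree4 x zero d4 = ≤-reflexive (cong₂ _+_ (path-degree-of-degree4 x zero d4)
    (trans (port-degree-of-degree4 x zero d4) (side-valid x (isYes-true⇒ (deg H x ℕ.≟ 4) d4))))
  level-degree≤3-of-degree4 x (suc zero) d4 = ≤-trans (≤-reflexive (cong₂ _+_ (path-degree-of-degree4 x (suc zero) d4)
    (trans (port-degree-of-degree4 x (suc zero) d4)
      (trans (countF-cong (λ y → ∧-zeroʳ (adj H x y))) (trans (countF-const (n H) false) (*-zeroʳ (n H)))))))
    (s≤s (s≤s z≤n))
  level-degree≤3-of-degree4 x (suc (suc zero)) d4 = ≤-reflexive (cong₂ _+_ (path-degree-of-degree4 x (suc (suc zero)) d4)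
    (trans (port-degree-of-degree4 x (suc (suc zero)) d4) (+-cancelˡ-≡ 2 _ _ (begin
      2 + countF (λ y → adj H x y ∧ not (side x y))
        ≡⟨ cong (_+ countF (λ y → adj H x y ∧ not (side x y))) (side-valid x deg≡4) ⟨
      countF (λ y → adj H x y ∧ side x y) + countF (λ y → adj H x y ∧ not (side x y))
        ≡⟨ countF-split (adj H x) (side x) ⟨
      deg H x
        ≡⟨ deg≡4 ⟩
      4 ∎))))
    where
    open ≡-Reasoning
    deg≡4 : deg H x ≡ 4
    deg≡4 = isYes-true⇒ (deg H x ℕ.≟ 4) d4

  level-degree≤3-otherwise : ∀ x i → is4 H x ≡ false → (i ==ᶠ zero) ≡ true → path-degree x i + port-degree x i ≤ 3
  level-degree≤3-otherwise x i d≢4 i≡0 = begin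
    path-degree x i + port-degree x i
      ≡⟨ cong₂ _+_ (trans (countF-cong (λ j → cong (_∧ pathAdj i j) d≢4)) (countF-const 3 false))
           (countF-cong λ y → trans (cong (λ p → adj H x y ∧ (i ==ᶠ p)) (port-of-other y d≢4))
                                     (trans (cong (adj H x y ∧_) i≡0) (∧-identityʳ (adj H x y)))) ⟩
    deg H x
      ≤⟨ ≤-pred (≤∧≢⇒< (H-maxDegree x) (isYes-false⇒¬ (deg H x ℕ.≟ 4) d≢4)) ⟩
    3 ∎
    where open ≤-Reasoning

  level-degree≤3 : ∀ x i → T ((i ==ᶠ zero) ∨ is4 H x) → path-degree x i + port-degree x i ≤ 3
  level-degree≤3 x i = by-degree (is4 H x) refl
    where
    by-degree : ∀ b → is4 H x ≡ b → T ((i ==ᶠ zero) ∨ b) → path-degree x i + port-degree x i ≤ 3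
    by-degree true  d4  _     = level-degree≤3-of-degree4 x i d4
    by-degree false d≢4 valid =
      level-degree≤3-otherwise x i d≢4 (Equivalence.to T-≡ (subst T (∨-identityʳ (i ==ᶠ zero)) valid))

  module _ (G : Graph) (iso : IsoR2 G H side) where

    private
      to : Fin (n G) → R2V H
      to = Inverse.to (proj₁ iso)

    base : Fin (n G) → Fin (n H)
    base u = proj₁ (proj₁ (to u))

    level : Fin (n G) → Fin 3
    level u = proj₂ (proj₁ (to u))

    adj-G≡link : ∀ u v → adj G u v ≡ link (base u) (level u) (base v) (level v)
    adj-G≡link = proj₂ iso

    base-level-injective : ∀ u v → base u ≡ base v → level u ≡ level v → u ≡ v
    base-level-injective u v b l = Injection.injective (Inverse⇒Injection (proj₁ iso))
      (Σ-≡,≡→≡ (cong₂ _,_ b l , T-irrelevant _ _))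

    private
      link-G : ∀ u v → adj G u v ≡ true → link (base u) (level u) (base v) (level v) ≡ true
      link-G u v uv = trans (sym (adj-G≡link u v)) uv

    R2-symmetric : SymmetricAdj G
    R2-symmetric u v = trans (adj-G≡link u v) (trans (link-sym _ _ _ _) (sym (adj-G≡link v u)))

    R2-triangleFree : TriangleFree G
    R2-triangleFree a b c ab bc ac = link-triangleFree _ _ _ _ _ _ (link-G a b ab) (link-G b c bc) (link-G a c ac)

    R2-maxDegree : MaxDegree 3 G
    R2-maxDegree u = begin
      deg G u
        ≡⟨ countF-split (adj G u) (λ v → base v ==ᶠ x) ⟩
      countF (λ v → adj G u v ∧ (base v ==ᶠ x)) + countF (λ v → adj G u v ∧ not (base v ==ᶠ x))
        ≤⟨ +-mono-≤ same-base≤path-degree cross≤port-degree ⟩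
      path-degree x i + port-degree x i
        ≤⟨ level-degree≤3 x i (proj₂ (to u)) ⟩
      3 ∎
      where
      open ≤-Reasoning
      x = base u
      i = level u

      cross-link : ∀ v → (adj G u v ∧ not (base v ==ᶠ x)) ≡ true →
        adj H x (base v) ≡ true × i ≡ port x (base v) × level v ≡ port (base v) x
      cross-link v h = link-cross x i (base v) (level v)
        (λ x≡v → ==ᶠ-false⇒≢ (not-true⇒false (∧-conicalʳ _ _ h)) (sym x≡v)) (link-G u v (∧-conicalˡ _ _ h))

      same-base≤path-degree : countF (λ v → adj G u v ∧ (base v ==ᶠ x)) ≤ path-degree x i
      same-base≤path-degree =
        countF-injection (λ v → adj G u v ∧ (base v ==ᶠ x)) (λ j → is4 H x ∧ pathAdj i j) level
          (λ v h → link-same-base x i (level v) (subst (λ y → link x i y (level v) ≡ true)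
             (==ᶠ-true⇒≡ (∧-conicalʳ _ _ h)) (link-G u v (∧-conicalˡ _ _ h))))
          (λ v₁ v₂ h₁ h₂ → base-level-injective v₁ v₂
             (trans (==ᶠ-true⇒≡ (∧-conicalʳ _ _ h₁)) (sym (==ᶠ-true⇒≡ (∧-conicalʳ _ _ h₂)))))

      cross≤port-degree : countF (λ v → adj G u v ∧ not (base v ==ᶠ x)) ≤ port-degree x i
      cross≤port-degree =
        countF-injection (λ v → adj G u v ∧ not (base v ==ᶠ x)) (λ y → adj H x y ∧ (i ==ᶠ port x y)) base
          (λ v h → let xv , i≡port , _ = cross-link v h in
             ∧-intro xv (subst (λ p → (i ==ᶠ p) ≡ true) i≡port (==ᶠ-refl i)))
          (λ v₁ v₂ h₁ h₂ b₁≡b₂ → base-level-injective v₁ v₂ b₁≡b₂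
             (trans (proj₂ (proj₂ (cross-link v₁ h₁)))
               (trans (cong (λ y → port y x) b₁≡b₂) (sym (proj₂ (proj₂ (cross-link v₂ h₂)))))))

inClass⇒triangleFree-subcubic : ∀ G → InClass G → SymmetricAdj G × TriangleFree G × MaxDegree 3 G
inClass⇒triangleFree-subcubic G (G' , simple , regular , Ê , valid , side , side-valid , iso) =
  R2-symmetric G iso , R2-triangleFree G iso , R2-maxDegree G iso
  where
  open Subdivision G' Ê simple regular valid using (R1-symmetric; R1-loopless; R1-triangleFree; R1-maxDegree)
  open Splitting (R1 G' Ê) side side-valid R1-symmetric R1-loopless R1-triangleFree R1-maxDegree
    using (R2-symmetric; R2-triangleFree; R2-maxDegree)

module Edges (G : Graph) (G-sym : SymmetricAdj G) where

  Edge : Set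
  Edge = Fin (nE G)

  end₁ end₂ : Edge → Fin (n G)
  end₁ p = proj₁ (lookup (E G) p)
  end₂ p = proj₂ (lookup (E G) p)

  end₁<end₂ : ∀ p → end₁ p F.< end₂ p
  end₁<end₂ p = proj₁ (∈-edgeList⁻ (adj G) (∈-lookup p))

  ends-adj : ∀ p → adj G (end₁ p) (end₂ p) ≡ true
  ends-adj p = proj₂ (∈-edgeList⁻ (adj G) (∈-lookup p))

  ends-injective : ∀ {p q} → end₁ p ≡ end₁ q → end₂ p ≡ end₂ q → p ≡ q
  ends-injective {p} {q} eq₁ eq₂ = lookup-injective (edgeList-unique (adj G)) p q (cong₂ _,_ eq₁ eq₂)

  touches : Edge → Fin (n G) → Bool
  touches p i = (end₁ p ==ᶠ i) ∨ (end₂ p ==ᶠ i)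

  end₁≢end₂ : ∀ p → end₁ p ≢ end₂ p
  end₁≢end₂ p eq = FinP.<-irrefl eq (end₁<end₂ p)

  touches-end₁ : ∀ p → touches p (end₁ p) ≡ true
  touches-end₁ p rewrite ==ᶠ-refl (end₁ p) = refl

  touches-end₂ : ∀ p → touches p (end₂ p) ≡ true
  touches-end₂ p rewrite ==ᶠ-refl (end₂ p) = ∨-zeroʳ _

  touches⇒end : ∀ {p i} → touches p i ≡ true → end₁ p ≡ i ⊎ end₂ p ≡ i
  touches⇒end {p} {i} h with end₁ p ==ᶠ i in e₁
  ... | true  = inj₁ (==ᶠ-true⇒≡ e₁)
  ... | false = inj₂ (==ᶠ-true⇒≡ h)

  end⇒touches : ∀ {p i} → end₁ p ≡ i ⊎ end₂ p ≡ i → touches p i ≡ true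
  end⇒touches {p} (inj₁ refl) = touches-end₁ p
  end⇒touches {p} (inj₂ refl) = touches-end₂ p

  not-touches⇒≢ : ∀ {p i} → touches p i ≡ false → end₁ p ≢ i × end₂ p ≢ i
  not-touches⇒≢ h = (λ e → not-¬ (end⇒touches (inj₁ e)) h) , (λ e → not-¬ (end⇒touches (inj₂ e)) h)

  touches-two⇒≡ : ∀ {a b} p q → a ≢ b → touches p a ≡ true → touches p b ≡ true →
    touches q a ≡ true → touches q b ≡ true → p ≡ q
  touches-two⇒≡ {a} {b} p q a≢b pa pb qa qb
    with touches⇒end pa | touches⇒end pb | touches⇒end qa | touches⇒end qb
  ... | inj₁ eq₁ | inj₁ eq₂ | _        | _        = contradiction (trans (sym eq₁) eq₂) a≢b
  ... | inj₂ eq₁ | inj₂ eq₂ | _        | _        = contradiction (trans (sym eq₁) eq₂) a≢b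
  ... | _        | _        | inj₁ eq₃ | inj₁ eq₄ = contradiction (trans (sym eq₃) eq₄) a≢b
  ... | _        | _        | inj₂ eq₃ | inj₂ eq₄ = contradiction (trans (sym eq₃) eq₄) a≢b
  ... | inj₁ eq₁ | inj₂ eq₂ | inj₁ eq₃ | inj₂ eq₄ = ends-injective (trans eq₁ (sym eq₃)) (trans eq₂ (sym eq₄))
  ... | inj₂ eq₁ | inj₁ eq₂ | inj₂ eq₃ | inj₁ eq₄ = ends-injective (trans eq₂ (sym eq₄)) (trans eq₁ (sym eq₃))
  ... | inj₁ eq₁ | inj₂ eq₂ | inj₂ eq₃ | inj₁ eq₄ = contradiction
    (subst₂ F._<_ (trans eq₄ (sym eq₂)) (trans eq₃ (sym eq₁)) (end₁<end₂ q)) (FinP.<-asym (end₁<end₂ p))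
  ... | inj₂ eq₁ | inj₁ eq₂ | inj₁ eq₃ | inj₂ eq₄ = contradiction
    (subst₂ F._<_ (trans eq₃ (sym eq₁)) (trans eq₄ (sym eq₂)) (end₁<end₂ q)) (FinP.<-asym (end₁<end₂ p))

  touches-two⇒adj : ∀ {a b} p → a ≢ b → touches p a ≡ true → touches p b ≡ true → adj G a b ≡ true
  touches-two⇒adj p a≢b pa pb with touches⇒end pa | touches⇒end pb
  ... | inj₁ refl | inj₁ refl = contradiction refl a≢b
  ... | inj₂ refl | inj₂ refl = contradiction refl a≢b
  ... | inj₁ refl | inj₂ refl = ends-adj p
  ... | inj₂ refl | inj₁ refl = trans (G-sym _ _) (ends-adj p)

  other : Edge → Fin (n G) → Fin (n G)
  other p a = if end₁ p ==ᶠ a then end₂ p else end₁ p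

  other-≢ : ∀ p a → touches p a ≡ true → other p a ≢ a
  other-≢ p a pa with end₁ p ==ᶠ a in e₁
  ... | true  = λ e₂≡a → end₁≢end₂ p (trans (==ᶠ-true⇒≡ e₁) (sym e₂≡a))
  ... | false = ==ᶠ-false⇒≢ e₁

  touches-other : ∀ p a → touches p (other p a) ≡ true
  touches-other p a with end₁ p ==ᶠ a
  ... | true  = touches-end₂ p
  ... | false = touches-end₁ p

  adj-other : ∀ p a → touches p a ≡ true → adj G a (other p a) ≡ true
  adj-other p a pa = touches-two⇒adj p (other-≢ p a pa ∘ sym) pa (touches-other p a)

  other-injective : ∀ {p q} a → touches p a ≡ true → touches q a ≡ true → other p a ≡ other q a → p ≡ q
  other-injective {p} {q} a pa qa eq = touches-two⇒≡ p q (other-≢ p a pa ∘ sym) pa (touches-other p a) qa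
    (subst (λ v → touches q v ≡ true) (sym eq) (touches-other q a))

  countF-touches : ∀ p → countF (touches p) ≡ 2
  countF-touches p = begin
    countF (touches p)
      ≡⟨ countF-split (touches p) (_==ᶠ end₁ p) ⟩
    countF (λ i → touches p i ∧ (i ==ᶠ end₁ p)) + countF (λ i → touches p i ∧ not (i ==ᶠ end₁ p))
      ≡⟨ cong₂ _+_ (trans (countF-cong at-end₁) (countF-==ᶠ (end₁ p)))
                   (trans (countF-cong off-end₁) (countF-==ᶠ (end₂ p))) ⟩
    2 ∎
    where
    open ≡-Reasoning
    at-end₁ : ∀ i → (touches p i ∧ (i ==ᶠ end₁ p)) ≡ (i ==ᶠ end₁ p)
    at-end₁ i with i F.≟ end₁ p
    ... | yes refl rewrite touches-end₁ p = refl
    ... | no _ = ∧-zeroʳ _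
    off-end₁ : ∀ i → (touches p i ∧ not (i ==ᶠ end₁ p)) ≡ (i ==ᶠ end₂ p)
    off-end₁ i with i F.≟ end₁ p
    ... | yes refl = trans (∧-zeroʳ _) (sym (≢⇒==ᶠ-false (end₁≢end₂ p)))
    ... | no i≢end₁ = trans (∧-identityʳ _)
      (trans (cong (_∨ (end₂ p ==ᶠ i)) (≢⇒==ᶠ-false (i≢end₁ ∘ sym))) (==ᶠ-sym (end₂ p) i))

  module _ (S : Edge → Bool) where

    load : Fin (n G) → ℕ
    load i = countF (λ p → S p ∧ touches p i)

    covered : Fin (n G) → Bool
    covered i = nonzero (load i)

    covered-by : ∀ {p i} → S p ≡ true → touches p i ≡ true → covered i ≡ true
    covered-by {p} {i} Sp pi = cong not (isYes-false (load i ℕ.≟ 0) λ load≡0 →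
      contradiction (subst (1 ≤_) load≡0 (length≤countF (λ q → S q ∧ touches q i) (p ∷ []) ([] ∷ []) (∧-intro Sp pi ∷ []))) λ ())

    load≤3 : MaxDegree 3 G → ∀ i → load i ≤ 3
    load≤3 G-maxDegree i = ≤-trans
      (countF-injection (λ p → S p ∧ touches p i) (adj G i) (λ p → other p i)
        (λ p h → adj-other p i (∧-conicalʳ _ _ h))
        (λ p q hp hq → other-injective i (∧-conicalʳ _ _ hp) (∧-conicalʳ _ _ hq)))
      (G-maxDegree i)

    sumF-load : sumF (n G) load ≡ 2 * countF S
    sumF-load = begin
      sumF (n G) load
        ≡⟨ sumF-comm (nE G) (n G) (λ p i → indicator (S p ∧ touches p i)) ⟩
      sumF (nE G) (λ p → countF (λ i → S p ∧ touches p i))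
        ≡⟨ sumF-cong (nE G) load-of-edge ⟩
      sumF (nE G) (λ p → 2 * indicator (S p))
        ≡⟨ sumF-distribˡ-* (nE G) 2 (indicator ∘ S) ⟩
      2 * countF S ∎
      where
      open ≡-Reasoning
      load-of-edge : ∀ p → countF (λ i → S p ∧ touches p i) ≡ 2 * indicator (S p)
      load-of-edge p with S p
      ... | true  = countF-touches p
      ... | false = trans (countF-const (n G) false) (*-zeroʳ (n G))

    private
      edge-and-two-cover-four : ∀ {p u v} → S p ≡ true → touches p u ≡ false → touches p v ≡ false → u ≢ v →
        covered u ≡ true → covered v ≡ true → 4 ≤ countF covered
      edge-and-two-cover-four {p} {u} {v} Sp pu pv u≢v cu cv =
        length≤countF covered (end₁ p ∷ end₂ p ∷ u ∷ v ∷ [])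
          ((end₁≢end₂ p ∷ e₁≢u ∷ e₁≢v ∷ []) ∷ (e₂≢u ∷ e₂≢v ∷ []) ∷ (u≢v ∷ []) ∷ [] ∷ [])
          (covered-by Sp (touches-end₁ p) ∷ covered-by Sp (touches-end₂ p) ∷ cu ∷ cv ∷ [])
        where
        e₁≢u = proj₁ (not-touches⇒≢ pu)
        e₂≢u = proj₂ (not-touches⇒≢ pu)
        e₁≢v = proj₁ (not-touches⇒≢ pv)
        e₂≢v = proj₂ (not-touches⇒≢ pv)

      claw-at : ∀ u → load u ≡ 3 → ThreeDistinct (λ q → S q ∧ touches q u)
      claw-at u load≡3 = threeDistinct-from-countF (λ q → S q ∧ touches q u) (≤-reflexive (sym load≡3))

      edge-away-from : ∀ u → load u ≡ 3 → 4 ≤ countF S → 1 ≤ countF (λ p → S p ∧ not (touches p u))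
      edge-away-from u load≡3 4≤|S| = +-cancelˡ-≤ 3 1 _ (subst (4 ≤_)
        (trans (countF-split S (λ p → touches p u)) (cong (_+ countF (λ p → S p ∧ not (touches p u))) load≡3)) 4≤|S|)

      u≢end : ∀ {u p e} → (S p ∧ not (touches p u)) ≡ true → touches p e ≡ true → u ≢ e
      u≢end h pe refl = not-¬ pe (not-true⇒false (∧-conicalʳ _ _ h))

      fresh-end : ∀ p q → p ≢ q → ∃[ x ] touches p x ≡ true × touches q x ≡ false
      fresh-end p q p≢q with touches q (end₁ p) in q₁ | touches q (end₂ p) in q₂
      ... | false | _     = end₁ p , touches-end₁ p , q₁
      ... | true  | false = end₂ p , touches-end₂ p , q₂
      ... | true  | true  = contradiction
        (touches-two⇒≡ p q (end₁≢end₂ p) (touches-end₁ p) (touches-end₂ p) q₁ q₂) p≢q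

    -- u, its three neighbours along the claw, and z (no neighbour, as ¬ adj u z) are five covered vertices
    claw-and-vertex-cover-five : ∀ {u z} → ThreeDistinct (λ q → S q ∧ touches q u) → u ≢ z →
      adj G u z ≡ false → covered z ≡ true → 5 ≤ countF covered
    claw-and-vertex-cover-five {u} {z} (threeDistinct q₁ q₂ q₃ h₁ h₂ h₃ q₁≢q₂ q₁≢q₃ q₂≢q₃) u≢z uz cz =
      length≤countF covered (u ∷ other q₁ u ∷ other q₂ u ∷ other q₃ u ∷ z ∷ [])
        ((u≢n h₁ ∷ u≢n h₂ ∷ u≢n h₃ ∷ u≢z ∷ []) ∷ (n≢n h₁ h₂ q₁≢q₂ ∷ n≢n h₁ h₃ q₁≢q₃ ∷ n≢z h₁ ∷ [])
          ∷ (n≢n h₂ h₃ q₂≢q₃ ∷ n≢z h₂ ∷ []) ∷ (n≢z h₃ ∷ []) ∷ [] ∷ [])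
        (covered-by (∧-conicalˡ _ _ h₁) (∧-conicalʳ _ _ h₁)
          ∷ covered-by (∧-conicalˡ _ _ h₁) (touches-other q₁ u)
          ∷ covered-by (∧-conicalˡ _ _ h₂) (touches-other q₂ u)
          ∷ covered-by (∧-conicalˡ _ _ h₃) (touches-other q₃ u) ∷ cz ∷ [])
      where
      u≢n : ∀ {q} → (S q ∧ touches q u) ≡ true → u ≢ other q u
      u≢n {q} h = other-≢ q u (∧-conicalʳ _ _ h) ∘ sym
      n≢n : ∀ {q q'} → (S q ∧ touches q u) ≡ true → (S q' ∧ touches q' u) ≡ true → q ≢ q' → other q u ≢ other q' u
      n≢n h h' q≢q' = q≢q' ∘ other-injective u (∧-conicalʳ _ _ h) (∧-conicalʳ _ _ h')
      n≢z : ∀ {q} → (S q ∧ touches q u) ≡ true → other q u ≢ z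
      n≢z {q} h refl = not-¬ (adj-other q u (∧-conicalʳ _ _ h)) uz

    module _ (G-triangleFree : TriangleFree G) where

      private
        -- x, y are ends of q, r off p. The ends of p and two of x, other q x, y, other r y are four covered
        -- vertices, unless x = y and other q x, other r x both lie on p; then these two and x form a triangle.
        two-edges-off-edge : ∀ {p q r x y} → S p ≡ true → S q ≡ true → S r ≡ true → q ≢ r →
          touches q x ≡ true → touches p x ≡ false → touches r y ≡ true → touches p y ≡ false →
          ∀ {b b'} → touches p (other q x) ≡ b → touches p (other r y) ≡ b' → Dec (x ≡ y) → 4 ≤ countF covered
        two-edges-off-edge {q = q} {x = x} Sp Sq Sr q≢r qx px ry py {false} px' _ _ =
          edge-and-two-cover-four Sp px px' (other-≢ q x qx ∘ sym) (covered-by Sq qx) (covered-by Sq (touches-other q x))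
        two-edges-off-edge {r = r} {y = y} Sp Sq Sr q≢r qx px ry py {true} {false} _ py' _ =
          edge-and-two-cover-four Sp py py' (other-≢ r y ry ∘ sym) (covered-by Sr ry) (covered-by Sr (touches-other r y))
        two-edges-off-edge Sp Sq Sr q≢r qx px ry py {true} {true} _ _ (no x≢y) =
          edge-and-two-cover-four Sp px py x≢y (covered-by Sq qx) (covered-by Sr ry)
        two-edges-off-edge {p} {q} {r} {x} Sp Sq Sr q≢r qx px ry py {true} {true} px' py' (yes refl) =
          ⊥-elim (G-triangleFree (other q x) (other r x) x
            (touches-two⇒adj p (q≢r ∘ other-injective x qx ry) px' py')
            (trans (G-sym _ _) (adj-other r x ry))
            (trans (G-sym _ _) (adj-other q x qx)))

      three-edges-cover-four : 3 ≤ countF S → 4 ≤ countF covered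
      three-edges-cover-four 3≤|S| = from-triple (threeDistinct-from-countF S 3≤|S|)
        where
        from-triple : ThreeDistinct S → 4 ≤ countF covered
        from-triple (threeDistinct p q r Sp Sq Sr p≢q p≢r q≢r) =
          from-ends (fresh-end q p (p≢q ∘ sym)) (fresh-end r p (p≢r ∘ sym))
          where
          from-ends : ∃[ x ] touches q x ≡ true × touches p x ≡ false →
                      ∃[ y ] touches r y ≡ true × touches p y ≡ false → 4 ≤ countF covered
          from-ends (x , qx , px) (y , ry , py) = two-edges-off-edge Sp Sq Sr q≢r qx px ry py refl refl (x F.≟ y)

      claw-and-edge-cover-five : ∀ u → load u ≡ 3 → 4 ≤ countF S → 5 ≤ countF covered
      claw-and-edge-cover-five u load≡3 4≤|S|
        with p , h ← countF-positive (λ p → S p ∧ not (touches p u)) (edge-away-from u load≡3 4≤|S|)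
        with adj G u (end₁ p) in u₁ | adj G u (end₂ p) in u₂
      ... | true  | true  = ⊥-elim (G-triangleFree u (end₁ p) (end₂ p) u₁ (ends-adj p) u₂)
      ... | false | _     = claw-and-vertex-cover-five (claw-at u load≡3) (u≢end h (touches-end₁ p)) u₁
                              (covered-by (∧-conicalˡ _ _ h) (touches-end₁ p))
      ... | true  | false = claw-and-vertex-cover-five (claw-at u load≡3) (u≢end h (touches-end₂ p)) u₂
                              (covered-by (∧-conicalˡ _ _ h) (touches-end₂ p))

-- Impurity bounds for a single cluster

prodF-weighted-≤ : ∀ n c (f : ℕ → ℕ) (w : Fin n → ℕ) →
  (∀ i → f (w i) * c ^ indicator (nonzero (w i)) ≤ c ^ w i) →
  prodF n (f ∘ w) * c ^ countF (nonzero ∘ w) ≤ c ^ sumF n w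
prodF-weighted-≤ n c f w f≤ = begin
  prodF n (f ∘ w) * c ^ countF (nonzero ∘ w)
    ≡⟨ cong (prodF n (f ∘ w) *_) (prodF-^ n c (indicator ∘ nonzero ∘ w)) ⟨
  prodF n (f ∘ w) * prodF n (λ i → c ^ indicator (nonzero (w i)))
    ≡⟨ prodF-distrib-* n (f ∘ w) _ ⟨
  prodF n (λ i → f (w i) * c ^ indicator (nonzero (w i)))
    ≤⟨ prodF-mono-≤ n f≤ ⟩
  prodF n (λ i → c ^ w i)
    ≡⟨ prodF-^ n c w ⟩
  c ^ sumF n w ∎
  where open ≤-Reasoning

private
  by-computation : ∀ {a b} → T (a ≤ᵇ b) → a ≤ b
  by-computation {a} {b} = ≤ᵇ⇒≤ a b

self-power-≤-4 : ∀ x → x ≤ 2 → x ^ x * 4 ^ indicator (nonzero x) ≤ 4 ^ x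
self-power-≤-4 0 _ = by-computation tt
self-power-≤-4 1 _ = by-computation tt
self-power-≤-4 2 _ = by-computation tt
self-power-≤-4 (suc (suc (suc _))) (s≤s (s≤s ()))

self-power²-≤-27 : ∀ x → x ≤ 3 → x ^ x * x ^ x * 27 ^ indicator (nonzero x) ≤ 27 ^ x
self-power²-≤-27 0 _ = by-computation tt
self-power²-≤-27 1 _ = by-computation tt
self-power²-≤-27 2 _ = by-computation tt
self-power²-≤-27 3 _ = by-computation tt
self-power²-≤-27 (suc (suc (suc (suc _)))) (s≤s (s≤s (s≤s ())))

self-power-≤-3 : ∀ x → x ≤ 3 → x ^ x ≤ 3 ^ x
self-power-≤-3 0 _ = by-computation tt
self-power-≤-3 1 _ = by-computation tt
self-power-≤-3 2 _ = by-computation tt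
self-power-≤-3 3 _ = by-computation tt
self-power-≤-3 (suc (suc (suc (suc _)))) (s≤s (s≤s (s≤s ())))

-- X = 2² · 3⁶, so log₂ X = 2 + 6 log₂ 3
X : ℕ
X = 2916

-- log₂ ((2s)^(2s) / D) ≥ 16 (s − 3) + (4 − s) log₂ X, multiplied out so that no exponent is negative
ImpurityBound : ℕ → ℕ → Set
ImpurityBound s D = D * 2 ^ (16 * s) * X ^ 4 ≤ (2 * s) ^ (2 * s) * 2 ^ 48 * X ^ s

ImpurityBound-antitone : ∀ s {D D'} → D ≤ D' → ImpurityBound s D' → ImpurityBound s D
ImpurityBound-antitone s D≤D' = ≤-trans (*-monoˡ-≤ (X ^ 4) (*-monoˡ-≤ (2 ^ (16 * s)) D≤D'))

≤-from-square : ∀ D M c K → D * D * c ≤ K → K < suc M * suc M * c → D ≤ M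
≤-from-square D M c K D²c≤K K<M'²c with D ℕ.≤? M
... | yes D≤M = D≤M
... | no  D≰M = contradiction (≤-trans (*-monoˡ-≤ c (*-mono-≤ M<D M<D)) D²c≤K) (<⇒≱ K<M'²c)
  where M<D = ≰⇒> D≰M

impurityBound-small : ∀ s D → 3 ≤ s → s ≤ 6 → D * 4 ^ 4 ≤ 4 ^ (2 * s) → ImpurityBound s D
impurityBound-small 3 D _ _ h = ImpurityBound-antitone 3 (*-cancelʳ-≤ D 16 256 h) (by-computation tt)
impurityBound-small 4 D _ _ h = ImpurityBound-antitone 4 (*-cancelʳ-≤ D 256 256 h) (by-computation tt)
impurityBound-small 5 D _ _ h = ImpurityBound-antitone 5 (*-cancelʳ-≤ D 4096 256 h) (by-computation tt)
impurityBound-small 6 D _ _ h = ImpurityBound-antitone 6 (*-cancelʳ-≤ D 65536 256 h) (by-computation tt)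
impurityBound-small 0 D () _ _
impurityBound-small 1 D (s≤s ()) _ _
impurityBound-small 2 D (s≤s (s≤s ())) _ _
impurityBound-small (suc (suc (suc (suc (suc (suc (suc _))))))) D _ (s≤s (s≤s (s≤s (s≤s (s≤s (s≤s ())))))) _

impurityBound-medium : ∀ s D → 4 ≤ s → s ≤ 6 → D * D * 27 ^ 5 ≤ 27 ^ (2 * s) → ImpurityBound s D
impurityBound-medium 4 D _ _ h = ImpurityBound-antitone 4 (≤-from-square D 140 (27 ^ 5) _ h (by-computation tt)) (by-computation tt)
impurityBound-medium 5 D _ _ h = ImpurityBound-antitone 5 (≤-from-square D 3787 (27 ^ 5) _ h (by-computation tt)) (by-computation tt)
impurityBound-medium 6 D _ _ h = ImpurityBound-antitone 6 (≤-from-square D 102275 (27 ^ 5) _ h (by-computation tt)) (by-computation tt)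
impurityBound-medium 0 D () _ _
impurityBound-medium 1 D (s≤s ()) _ _
impurityBound-medium 2 D (s≤s (s≤s ())) _ _
impurityBound-medium 3 D (s≤s (s≤s (s≤s ()))) _ _
impurityBound-medium (suc (suc (suc (suc (suc (suc (suc _))))))) D _ (s≤s (s≤s (s≤s (s≤s (s≤s (s≤s ())))))) _

private
  self-power-step : ∀ s x Q → (2 + 2 * s) * (2 + 2 * s) * x * ((2 * s) ^ (2 * s) * Q * x ^ s) ≤
                              (2 * suc s) ^ (2 * suc s) * Q * x ^ suc s
  self-power-step s x Q = begin
    (2 + 2 * s) * (2 + 2 * s) * x * ((2 * s) ^ (2 * s) * Q * x ^ s)
      ≤⟨ *-monoʳ-≤ ((2 + 2 * s) * (2 + 2 * s) * x)
           (*-monoˡ-≤ (x ^ s) (*-monoˡ-≤ Q (^-monoˡ-≤ (2 * s) (m≤n+m (2 * s) 2)))) ⟩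
    (2 + 2 * s) * (2 + 2 * s) * x * ((2 + 2 * s) ^ (2 * s) * Q * x ^ s)
      ≡⟨ collect (2 + 2 * s) x ((2 + 2 * s) ^ (2 * s)) Q (x ^ s) ⟩
    (2 + 2 * s) ^ (2 + 2 * s) * Q * x ^ suc s
      ≡⟨ cong (λ a → a ^ a * Q * x ^ suc s) (*-suc 2 s) ⟨
    (2 * suc s) ^ (2 * suc s) * Q * x ^ suc s ∎
    where
    open ≤-Reasoning
    collect : ∀ a x P Q Y → a * a * x * (P * Q * Y) ≡ a * (a * P) * Q * (x * Y)
    collect = solve-∀

  power-step : ∀ a b c s → a ^ (2 * suc s) * b ^ (16 * suc s) * c ≡ a * a * b ^ 16 * (a ^ (2 * s) * b ^ (16 * s) * c)
  power-step a b c s = begin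
    a ^ (2 * suc s) * b ^ (16 * suc s) * c
      ≡⟨ cong₂ (λ m n → a ^ m * b ^ n * c) (*-suc 2 s) (*-suc 16 s) ⟩
    a ^ (2 + 2 * s) * b ^ (16 + 16 * s) * c
      ≡⟨ cong (λ t → a ^ (2 + 2 * s) * t * c) (^-distribˡ-+-* b 16 (16 * s)) ⟩
    a * (a * a ^ (2 * s)) * (b ^ 16 * b ^ (16 * s)) * c
      ≡⟨ collect a (b ^ 16) (a ^ (2 * s)) (b ^ (16 * s)) c ⟩
    a * a * b ^ 16 * (a ^ (2 * s) * b ^ (16 * s) * c) ∎
    where
    open ≡-Reasoning
    collect : ∀ a k A B c → a * (a * A) * (k * B) * c ≡ a * a * k * (A * B * c)
    collect = solve-∀

  -- going from s to s + 1 multiplies the left side by 3² · 2¹⁶ and the right side by at least (2s + 2)² X ≥ 16² X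
  ImpurityBound-step : ∀ s → 7 ≤ s → ImpurityBound s (3 ^ (2 * s)) → ImpurityBound (suc s) (3 ^ (2 * suc s))
  ImpurityBound-step s 7≤s IH = begin
    3 ^ (2 * suc s) * 2 ^ (16 * suc s) * X ^ 4
      ≡⟨ power-step 3 2 (X ^ 4) s ⟩
    3 * 3 * 2 ^ 16 * (3 ^ (2 * s) * 2 ^ (16 * s) * X ^ 4)
      ≤⟨ *-mono-≤ (by-computation {3 * 3 * 2 ^ 16} {16 * 16 * X} tt) IH ⟩
    16 * 16 * X * ((2 * s) ^ (2 * s) * 2 ^ 48 * X ^ s)
      ≤⟨ *-monoˡ-≤ ((2 * s) ^ (2 * s) * 2 ^ 48 * X ^ s) (*-monoˡ-≤ X (*-mono-≤ 16≤2s+2 16≤2s+2)) ⟩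
    (2 + 2 * s) * (2 + 2 * s) * X * ((2 * s) ^ (2 * s) * 2 ^ 48 * X ^ s)
      ≤⟨ self-power-step s X (2 ^ 48) ⟩
    (2 * suc s) ^ (2 * suc s) * 2 ^ 48 * X ^ suc s ∎
    where
    open ≤-Reasoning
    16≤2s+2 : 16 ≤ 2 + 2 * s
    16≤2s+2 = +-monoʳ-≤ 2 (*-monoʳ-≤ 2 7≤s)

impurityBound-large : ∀ s D → 7 ≤ s → D ≤ 3 ^ (2 * s) → ImpurityBound s D
impurityBound-large s D 7≤s D≤ = ImpurityBound-antitone s D≤
  (subst (λ t → ImpurityBound t (3 ^ (2 * t))) (m∸n+n≡m 7≤s) (from-7 (s ∸ 7)))
  where
  from-7 : ∀ t → ImpurityBound (t + 7) (3 ^ (2 * (t + 7)))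
  from-7 zero    = by-computation tt
  from-7 (suc t) = ImpurityBound-step (t + 7) (m≤n+m 7 t) (from-7 t)

^-distribʳ-* : ∀ a b n → (a * b) ^ n ≡ a ^ n * b ^ n
^-distribʳ-* a b zero    = refl
^-distribʳ-* a b (suc n) rewrite ^-distribʳ-* a b n = medial a b (a ^ n) (b ^ n)
  where
  medial : ∀ a b x y → a * b * (x * y) ≡ a * x * (b * y)
  medial = solve-∀

X^≡ : ∀ t → X ^ t ≡ 2 ^ (2 * t) * 3 ^ (6 * t)
X^≡ t = trans (^-distribʳ-* 4 729 t) (cong₂ _*_ (^-*-assoc 2 2 t) (^-*-assoc 3 6 t))

-- the unfolded `inEGroup`, with the size s and `hasVertexOfDeg` at 3 and 2 abstracted as h₃ and h₂
e-group-shape : ∀ s h₃ h₂ →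
  (not (⌊ s ℕ.≟ 3 ⌋ ∧ h₃) ∧ not (⌊ s ℕ.≟ 2 ⌋ ∧ h₂) ∧ not ⌊ s ℕ.≟ 1 ⌋ ∧ not (⌊ s ℕ.≟ 2 ⌋ ∧ not h₂)) ≡ true →
  1 ≤ s → 3 ≤ s × (s ≡ 3 → h₃ ≡ false)
e-group-shape 1 _     _     () _
e-group-shape 2 _     true  () _
e-group-shape 2 _     false () _
e-group-shape 3 false _     _  _ = s≤s (s≤s (s≤s z≤n)) , λ _ → refl
e-group-shape (suc (suc (suc (suc _)))) _ _ _ _ = s≤s (s≤s (s≤s z≤n)) , λ ()

module ClusterImpurity (G : Graph) (G-sym : SymmetricAdj G) (G-triangleFree : TriangleFree G)
                       (G-maxDegree : MaxDegree 3 G) (k : ℕ) (C : Clustering G k) (c : Fin k) where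

  open Edges G G-sym

  -- with these members, Defs' `wvec G k C c` is `load members` by definition
  members : Edge → Bool
  members p = proj₁ C p ==ᶠ c

  private
    s = size G k C c
    w = wvec G k C c
    D = impDen G k C c

  impNum≡ : impNum G k C c ≡ (2 * s) ^ (2 * s)
  impNum≡ = cong (λ m → m ^ m) (sumF-load members)

  size-positive : 1 ≤ s
  size-positive with p , cl-p≡c ← proj₂ C c =
    length≤countF members (p ∷ []) ([] ∷ []) (subst (λ d → (proj₁ C p ==ᶠ d) ≡ true) cl-p≡c (==ᶠ-refl _) ∷ [])

  e-group-cluster-shape : inEGroup G k C c ≡ true → 3 ≤ s × (s ≡ 3 → ∀ i → w i ≢ 3)
  e-group-cluster-shape h with 3≤s , not-3-star ← e-group-shape s _ _ h size-positive =
    3≤s , λ s≡3 i → isYes-false⇒¬ (w i ℕ.≟ 3)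
      (countF≡0⇒false _ (isYes-true⇒ (_ ℕ.≟ 0) (not-injective (not-3-star s≡3))) i)

  private
    weights-bound : sumF (n G) w ≡ 2 * s
    weights-bound = sumF-load members

    D≤3^2s : D ≤ 3 ^ (2 * s)
    D≤3^2s = begin
      D
        ≤⟨ prodF-mono-≤ (n G) (λ i → self-power-≤-3 (w i) (load≤3 members G-maxDegree i)) ⟩
      prodF (n G) (λ i → 3 ^ w i)
        ≡⟨ prodF-^ (n G) 3 w ⟩
      3 ^ sumF (n G) w
        ≡⟨ cong (3 ^_) weights-bound ⟩
      3 ^ (2 * s) ∎
      where open ≤-Reasoning

    D-bound-small : (∀ i → w i ≤ 2) → 3 ≤ s → D * 4 ^ 4 ≤ 4 ^ (2 * s)
    D-bound-small w≤2 3≤s = begin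
      D * 4 ^ 4
        ≤⟨ *-monoʳ-≤ D (^-monoʳ-≤ 4 (three-edges-cover-four members G-triangleFree 3≤s)) ⟩
      D * 4 ^ countF (covered members)
        ≤⟨ prodF-weighted-≤ (n G) 4 (λ x → x ^ x) w (λ i → self-power-≤-4 (w i) (w≤2 i)) ⟩
      4 ^ sumF (n G) w
        ≡⟨ cong (4 ^_) weights-bound ⟩
      4 ^ (2 * s) ∎
      where open ≤-Reasoning

    D-bound-medium : ∀ u → w u ≡ 3 → 4 ≤ s → D * D * 27 ^ 5 ≤ 27 ^ (2 * s)
    D-bound-medium u wu≡3 4≤s = begin
      D * D * 27 ^ 5
        ≤⟨ *-monoʳ-≤ (D * D) (^-monoʳ-≤ 27 (claw-and-edge-cover-five members G-triangleFree u wu≡3 4≤s)) ⟩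
      D * D * 27 ^ countF (covered members)
        ≡⟨ cong (_* 27 ^ countF (covered members)) (prodF-distrib-* (n G) (λ i → w i ^ w i) (λ i → w i ^ w i)) ⟨
      prodF (n G) (λ i → w i ^ w i * w i ^ w i) * 27 ^ countF (covered members)
        ≤⟨ prodF-weighted-≤ (n G) 27 (λ x → x ^ x * x ^ x) w
             (λ i → self-power²-≤-27 (w i) (load≤3 members G-maxDegree i)) ⟩
      27 ^ sumF (n G) w
        ≡⟨ cong (27 ^_) weights-bound ⟩
      27 ^ (2 * s) ∎
      where open ≤-Reasoning

    impurityBound-by-size : 3 ≤ s → (s ≡ 3 → ∀ i → w i ≢ 3) → Dec (7 ≤ s) → Dec (∃ λ i → w i ≡ 3) →
      ImpurityBound s D
    impurityBound-by-size _ _ (yes 7≤s) _ = impurityBound-large s D 7≤s D≤3^2s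
    impurityBound-by-size 3≤s _ (no 7≰s) (no no-load-3) = impurityBound-small s D 3≤s (≤-pred (≰⇒> 7≰s))
      (D-bound-small (λ i → ≤-pred (≤∧≢⇒< (load≤3 members G-maxDegree i) (λ wi≡3 → no-load-3 (i , wi≡3)))) 3≤s)
    impurityBound-by-size 3≤s not-3-star (no 7≰s) (yes (u , wu≡3)) =
      impurityBound-medium s D 4≤s (≤-pred (≰⇒> 7≰s)) (D-bound-medium u wu≡3 4≤s)
      where
      4≤s : 4 ≤ s
      4≤s = ≤∧≢⇒< 3≤s λ 3≡s → not-3-star (sym 3≡s) u wu≡3

  e-group-impurityBound : inEGroup G k C c ≡ true → ImpurityBound s D
  e-group-impurityBound h = let 3≤s , not-3-star = e-group-cluster-shape h in
    impurityBound-by-size 3≤s not-3-star (7 ℕ.≤? s) (FinP.any? (λ i → w i ℕ.≟ 3))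

cancel-X^q : ∀ A B q e → q ≤ 4 * e → A * X ^ (4 * e) ≤ B * X ^ q →
  A * 2 ^ (2 * (4 * e ∸ q)) * 3 ^ (6 * (4 * e ∸ q)) ≤ B
cancel-X^q A B q e q≤4e h = *-cancelʳ-≤ _ B (X ^ q) {{m^n≢0 X q}} (begin
  A * 2 ^ (2 * t) * 3 ^ (6 * t) * X ^ q   ≡⟨ assoc A (2 ^ (2 * t)) (3 ^ (6 * t)) (X ^ q) ⟩
  A * (2 ^ (2 * t) * 3 ^ (6 * t) * X ^ q) ≡⟨ cong (λ y → A * (y * X ^ q)) (X^≡ t) ⟨
  A * (X ^ t * X ^ q)                     ≡⟨ cong (A *_) (^-distribˡ-+-* X t q) ⟨
  A * X ^ (t + q)                         ≡⟨ cong (λ m → A * X ^ m) (m∸n+n≡m q≤4e) ⟩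
  A * X ^ (4 * e)                         ≤⟨ h ⟩
  B * X ^ q                               ∎)
  where
  open ≤-Reasoning
  t = 4 * e ∸ q
  assoc : ∀ a p r y → a * p * r * y ≡ a * (p * r * y)
  assoc = solve-∀

-- the factor of one cluster in the product over all clusters, where b says whether it is in the e-group
guarded-impurityBound : ∀ b D N s → (b ≡ true → ImpurityBound s D) → N ≡ (2 * s) ^ (2 * s) →
  (if b then D else 1) * (2 ^ 16) ^ (if b then s else 0) * X ^ (if b then 4 else 0)
    ≤ (if b then N else 1) * (2 ^ 48) ^ indicator b * X ^ (if b then s else 0)
guarded-impurityBound false _ _ _ _ _    = ≤-refl
guarded-impurityBound true  D _ s bound refl = subst₂ _≤_
  (cong (λ p → D * p * X ^ 4) (sym (^-*-assoc 2 16 s)))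
  (cong (λ p → (2 * s) ^ (2 * s) * p * X ^ s) (sym (*-identityʳ (2 ^ 48))))
  (bound refl)

module _ (G : Graph) (G-sym : SymmetricAdj G) (G-triangleFree : TriangleFree G) (G-maxDegree : MaxDegree 3 G)
         (k : ℕ) (C : Clustering G k) where

  private
    inE = inEGroup G k C
    q = qCount G k C
    e = eCount G k C

  e-group-product-bound : eDen G k C * (2 ^ 16) ^ q * X ^ (4 * e) ≤ eNum G k C * (2 ^ 48) ^ e * X ^ q
  e-group-product-bound = subst₂ _≤_
    (trans (prodF-*-^-^ k _ (2 ^ 16) _ X (λ c → if inE c then 4 else 0))
           (cong (λ m → eDen G k C * (2 ^ 16) ^ q * X ^ m) (sumF-if-const k inE 4)))
    (prodF-*-^-^ k _ (2 ^ 48) (indicator ∘′ inE) X _)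
    (prodF-mono-≤ k λ c → guarded-impurityBound (inE c) _ _ _
      (ClusterImpurity.e-group-impurityBound G G-sym G-triangleFree G-maxDegree k C c)
      (ClusterImpurity.impNum≡ G G-sym G-triangleFree G-maxDegree k C c))

  e-group-impurity-bound : q < 4 * e →
    eDen G k C * 2 ^ (16 * q) * 2 ^ (2 * (4 * e ∸ q)) * 3 ^ (6 * (4 * e ∸ q)) ≤ eNum G k C * 2 ^ (48 * e)
  e-group-impurity-bound q<4e =
    cancel-X^q (eDen G k C * 2 ^ (16 * q)) (eNum G k C * 2 ^ (48 * e)) q e (<⇒≤ q<4e) (subst₂ (λ a b → eDen G k C * a * X ^ (4 * e) ≤ eNum G k C * b * X ^ q)
      (^-*-assoc 2 16 q) (^-*-assoc 2 48 e) e-group-product-bound)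

proposition3 : (G : Graph) → InClass G →
    (k : ℕ) → 1 ≤ k →
    (ε : ℚ) → Positive ε →
    (∀ (S : Fin′ G) → IsVertexCover G S → ((+ k / 1) *ℚ (1ℚ +ℚ ε)) ≤ℚ (+ countF S / 1)) →
    (C : Clustering G k) → IsOptimal G k C →
    qCount G k C < 4 * eCount G k C →
    eDen G k C * 2 ^ (16 * qCount G k C) * 2 ^ (2 * (4 * eCount G k C ∸ qCount G k C))
        * 3 ^ (6 * (4 * eCount G k C ∸ qCount G k C))
      ≤ eNum G k C * 2 ^ (48 * eCount G k C)
proposition3 G inClass k _ _ _ _ C _ q<4e =
  let G-sym , G-triangleFree , G-maxDegree = inClass⇒triangleFree-subcubic G inClass
  in e-group-impurity-bound G G-sym G-triangleFree G-maxDegree k C q<4e
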